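{- Let $p\ge 5$ be a prime, $n\in \mathbb{N}$ and $m\in \mathbb{Z}^{+}$. Then \begin{align*} &\sum_{\substack{p\nmid k,\ \lfloor k/p^{m}\rfloor=n\\ \{k/p^{m}\}<p^{m}/2}}\frac{1}{k^2}\equiv \frac{12n+7}{3}p^m B_{p-3}\pmod{p^{m+1}},\\ &\sum_{\substack{p\nmid k,\ \lfloor k/p^{m}\rfloor=n\\ \{k/p^{m}\}>p^{m}/2}}\frac{1}{k^2}\equiv -\frac{12n+5}{3}p^m B_{p-3}\pmod{p^{m+1}}. \end{align*}
   Context: The sums run over positive integers $k$ not divisible by $p$. Here $\lfloor x\rfloor$ is the integral part of $x$, $\{k/p^{m}\}=k-p^m\lfloor k/p^{m}\rfloor$ is the remainder of $k$ divided by $p^m$, and $B_n$ are the Bernoulli numbers defined by $z/(e^z-1)=\sum_{n\ge0}B_n z^n/n!$. -}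

module Defs where

open import Data.Nat as ℕ using (ℕ; zero; suc; _^_; _<?_; _≤_)
open import Data.Nat.Divisibility using (_∣_; _∣?_)
open import Data.Nat.Combinatorics using (_C_)
open import Data.Integer as ℤ using (ℤ; +_)
open import Data.Rational using (ℚ; 0ℚ; 1ℚ; _/_; _+_; _*_; -_; _-_)
open import Data.List using (List; []; _∷_; zipWith; downFrom; upTo; foldr; map)
open import Data.Bool using (if_then_else_; _∨_; not)
open import Data.Product using (∃; _×_)
open import Relation.Nullary using (¬_; does)
open import Relation.Binary.PropositionalEquality using (_≡_)

ℕ→ℚ : ℕ → ℚ
ℕ→ℚ k = + k / 1

sumℚ : List ℚ → ℚ
sumℚ = foldr _+_ 0ℚ

-- bernRev n = [B_n, B_{n-1}, ..., B_0], via the recurrence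
-- sum_{j=0}^{n} C(n+1,j) B_j = 0 (n ≥ 1), B_0 = 1,
-- which is the recurrence of z/(e^z-1) = Σ B_n z^n/n!  (so B_1 = -1/2).
bernRev : ℕ → List ℚ
bernRev zero = 1ℚ ∷ []
bernRev (suc n) =
  (- ((+ 1 / suc (suc n)) *
      sumℚ (zipWith (λ j b → ℕ→ℚ (suc (suc n) C j) * b) (downFrom (suc n)) bs)))
  ∷ bs
  where bs = bernRev n

B : ℕ → ℚ
B n with bernRev n
... | [] = 0ℚ
... | b ∷ _ = b

-- 1/k^2 (the value at k = 0 is irrelevant: it is never used below since p ∣ 0)
invSq : ℕ → ℚ
invSq zero = 0ℚ
invSq (suc k) = (+ 1 / suc k) * (+ 1 / suc k)

-- Σ over k with p ∤ k, ⌊k/p^m⌋ = n, {k/p^m} < p^m/2 of 1/k^2.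
-- Write k = n p^m + r with 0 ≤ r < p^m; condition r < p^m/2 is 2r < p^m.
sumLower : (p n m : ℕ) → ℚ
sumLower p n m = sumℚ (map term (upTo (p ^ m)))
  where
  term : ℕ → ℚ
  term r = if does (p ∣? (n ℕ.* p ^ m ℕ.+ r)) ∨ not (does (2 ℕ.* r <? p ^ m))
           then 0ℚ else invSq (n ℕ.* p ^ m ℕ.+ r)

-- Same with {k/p^m} > p^m/2, i.e. p^m < 2r.
sumUpper : (p n m : ℕ) → ℚ
sumUpper p n m = sumℚ (map term (upTo (p ^ m)))
  where
  term : ℕ → ℚ
  term r = if does (p ∣? (n ℕ.* p ^ m ℕ.+ r)) ∨ not (does (p ^ m <? 2 ℕ.* r))
           then 0ℚ else invSq (n ℕ.* p ^ m ℕ.+ r)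

-- Congruence of rationals modulo p^e (p-adic sense):
-- a - b = p^e * (u / v) with u ∈ ℤ, v ∈ ℕ, p ∤ v.
CongModPow : (p e : ℕ) → ℚ → ℚ → Set
CongModPow p e a b =
  ∃ λ (u : ℤ) → ∃ λ (v : ℕ) → (¬ (p ∣ v)) × ((a - b) * ℕ→ℚ v ≡ ℕ→ℚ (p ^ e) * (u / 1))

-- Write P = p ^ m = 2 h - 1, let S be the sum of 1/r² over the r < P with p ∤ r, and let H₂, H₃
-- be the sums of 1/r², 1/r³ over the same r below h.  For p ^ m ∣ N, expanding 1/(N ± r)² around
-- 1/r² modulo N² turns the two sums of the theorem into H₂ ∓ 2 N H₃, with N = n P resp. (n + 1) P.
-- Pairing r with P - r, and 2r with P - 2r, gives S ≡ 2 H₂ + 2 P H₃ and 4 S ≡ 2 H₂ + P H₃, hence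
-- P H₃ ≡ -3 S and 2 H₂ ≡ 7 S, and it remains to show 3 S ≡ 2 P B_{p-3} (mod p ^ (m + 1)).
-- Passing from m to m + 1 multiplies S by p modulo p ^ (m + 2) (second order expansion over the
-- p blocks of length P).  For m = 1 the same two pairings applied to ∑ r ^ (p - 3), together with
-- Fermat's little theorem for 2 and ∑_{r<p} r ^ (p - 3) ≡ p B_{p-3} (mod p²), give the claim.
module Submission where

-- ℚ's arithmetic is opened only inside this module, so that the theorem at the end reads with
-- the operators of ℕ.
module _ where

  open import Agda.Builtin.FromNat using (Number; fromNat)
  open import Data.Unit.Base using (tt)
  open import Data.Bool.Base using (true; false; if_then_else_; _∨_; not)
  open import Data.Bool.Properties using (∨-identityʳ; ∨-zeroʳ)
  open import Data.Nat.Base as ℕ using (ℕ; zero; suc; z≤n; s≤s; _!)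
  import Data.Nat.Properties as ℕ
  import Data.Nat.Literals as ℕ
  import Data.Nat.Tactic.RingSolver as ℕ
  open import Data.Nat.Combinatorics
    using (_C_; nCk+nC[k+1]≡[n+1]C[k+1]; k>n⇒nCk≡0; nCn≡1; nCk≡nC[n∸k]; nC1≡n; nCk≡n!/k![n-k]!; k![n∸k]!∣n!)
  open import Data.Nat.Divisibility using (_∣_; _∣?_; divides; ∣⇒≤; ∣-refl; ∣-trans; ∣1⇒≡1; n∣m*n; ∣m∣n⇒∣m+n; ∣m+n∣m⇒∣n)
  open import Data.Nat.DivMod using (m/n*n≡m)
  open import Data.Nat.Primality using (Prime; euclidsLemma; prime⇒nonZero; prime⇒irreducible; ¬prime[1])
  open import Data.Integer.Base as ℤ using (ℤ)
  import Data.Integer.Properties as ℤ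
  import Data.Integer.Tactic.RingSolver as ℤ
  open import Data.Rational.Base as ℚ using (ℚ; 0ℚ; 1ℚ; _+_; _*_; -_; _-_; _/_; toℚᵘ)
  import Data.Rational.Properties as ℚ
  import Data.Rational.Literals as ℚ
  import Data.Rational.Unnormalised.Base as ℚᵘ
  import Data.Rational.Unnormalised.Properties as ℚᵘ
  open import Data.List.Base using (_∷_; []; map; upTo; downFrom; zipWith; applyUpTo)
  open import Data.Product.Base using (_×_; _,_; ∃-syntax; proj₁; proj₂)
  open import Data.Sum.Base using (_⊎_; inj₁; inj₂)
  open import Data.Empty using (⊥-elim)
  open import Function.Base using (_∘_)
  open import Relation.Nullary.Decidable using (does; yes; no; dec-true; dec-false; dec⇒maybe)
  open import Relation.Nullary.Negation using (¬_; contradiction)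
  open import Relation.Binary.Bundles using (Setoid)
  open import Relation.Binary.PropositionalEquality
  import Relation.Binary.Reasoning.Setoid as SetoidReasoning
  open import Tactic.RingSolver using (solve-∀; solve)
  open import Tactic.RingSolver.Core.AlmostCommutativeRing using (AlmostCommutativeRing; fromCommutativeRing)
  open import Defs using (ℕ→ℚ; sumℚ; bernRev; B; invSq; sumLower; sumUpper; CongModPow)

  instance
    ℕ-number : Number ℕ
    ℕ-number = ℕ.number
    ℚ-number : Number ℚ
    ℚ-number = ℚ.number

  ℚ-ring : AlmostCommutativeRing _ _
  ℚ-ring = fromCommutativeRing ℚ.+-*-commutativeRing (λ x → dec⇒maybe (0ℚ ℚ.≟ x))

  open AlmostCommutativeRing ℚ-ring using (_^_)
  open import Algebra.Properties.CommutativeSemiring.Exp.TCOptimised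
    (AlmostCommutativeRing.commutativeSemiring ℚ-ring) using (^-homo-*; ^-distrib-*)


  ℤ→ℚ : ℤ → ℚ
  ℤ→ℚ u = u / 1

  private
    toℚᵘ-/ : ∀ u n → toℚᵘ (u / suc n) ℚᵘ.≃ ℚᵘ.mkℚᵘ u n
    toℚᵘ-/ u n = ℚ.toℚᵘ-fromℚᵘ (ℚᵘ.mkℚᵘ u n)

    toℚᵘ-ℤ→ℚ : ∀ u → toℚᵘ (ℤ→ℚ u) ℚᵘ.≃ ℚᵘ.mkℚᵘ u 0
    toℚᵘ-ℤ→ℚ u = toℚᵘ-/ u 0

  ℤ→ℚ-+ : ∀ a b → ℤ→ℚ (a ℤ.+ b) ≡ ℤ→ℚ a + ℤ→ℚ b
  ℤ→ℚ-+ a b = ℚ.toℚᵘ-injective (begin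
    toℚᵘ (ℤ→ℚ (a ℤ.+ b))              ≈⟨ toℚᵘ-ℤ→ℚ (a ℤ.+ b) ⟩
    ℚᵘ.mkℚᵘ (a ℤ.+ b) 0               ≈⟨ ℚᵘ.*≡* (unnormalised a b) ⟩
    ℚᵘ.mkℚᵘ a 0 ℚᵘ.+ ℚᵘ.mkℚᵘ b 0      ≈⟨ ℚᵘ.+-cong (toℚᵘ-ℤ→ℚ a) (toℚᵘ-ℤ→ℚ b) ⟨
    toℚᵘ (ℤ→ℚ a) ℚᵘ.+ toℚᵘ (ℤ→ℚ b)    ≈⟨ ℚ.toℚᵘ-homo-+ (ℤ→ℚ a) (ℤ→ℚ b) ⟨
    toℚᵘ (ℤ→ℚ a + ℤ→ℚ b)              ∎)
    where
    open ℚᵘ.≃-Reasoning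
    unnormalised : ∀ a b → (a ℤ.+ b) ℤ.* ℤ.1ℤ ≡ (a ℤ.* ℤ.1ℤ ℤ.+ b ℤ.* ℤ.1ℤ) ℤ.* ℤ.1ℤ
    unnormalised = ℤ.solve-∀

  ℤ→ℚ-* : ∀ a b → ℤ→ℚ (a ℤ.* b) ≡ ℤ→ℚ a * ℤ→ℚ b
  ℤ→ℚ-* a b = ℚ.toℚᵘ-injective (begin
    toℚᵘ (ℤ→ℚ (a ℤ.* b))              ≈⟨ toℚᵘ-ℤ→ℚ (a ℤ.* b) ⟩
    ℚᵘ.mkℚᵘ (a ℤ.* b) 0               ≈⟨ ℚᵘ.*-cong (toℚᵘ-ℤ→ℚ a) (toℚᵘ-ℤ→ℚ b) ⟨
    toℚᵘ (ℤ→ℚ a) ℚᵘ.* toℚᵘ (ℤ→ℚ b)    ≈⟨ ℚ.toℚᵘ-homo-* (ℤ→ℚ a) (ℤ→ℚ b) ⟨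
    toℚᵘ (ℤ→ℚ a * ℤ→ℚ b)              ∎)
    where open ℚᵘ.≃-Reasoning

  ℤ→ℚ-neg : ∀ a → ℤ→ℚ (ℤ.- a) ≡ - ℤ→ℚ a
  ℤ→ℚ-neg a = ℚ.toℚᵘ-injective (begin
    toℚᵘ (ℤ→ℚ (ℤ.- a))      ≈⟨ toℚᵘ-ℤ→ℚ (ℤ.- a) ⟩
    ℚᵘ.mkℚᵘ (ℤ.- a) 0       ≈⟨ ℚᵘ.-‿cong (toℚᵘ-ℤ→ℚ a) ⟨
    ℚᵘ.- toℚᵘ (ℤ→ℚ a)       ≈⟨ ℚ.toℚᵘ-homo‿- (ℤ→ℚ a) ⟨
    toℚᵘ (- ℤ→ℚ a)          ∎)
    where open ℚᵘ.≃-Reasoning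

  ℕ→ℚ-+ : ∀ m n → ℕ→ℚ (m ℕ.+ n) ≡ ℕ→ℚ m + ℕ→ℚ n
  ℕ→ℚ-+ m n = trans (cong ℤ→ℚ (ℤ.pos-+ m n)) (ℤ→ℚ-+ (ℤ.+ m) (ℤ.+ n))

  ℕ→ℚ-* : ∀ m n → ℕ→ℚ (m ℕ.* n) ≡ ℕ→ℚ m * ℕ→ℚ n
  ℕ→ℚ-* m n = trans (cong ℤ→ℚ (ℤ.pos-* m n)) (ℤ→ℚ-* (ℤ.+ m) (ℤ.+ n))

  ℕ→ℚ-suc : ∀ n → ℕ→ℚ (suc n) ≡ ℕ→ℚ n + 1ℚ
  ℕ→ℚ-suc n = trans (ℕ→ℚ-+ 1 n) (ℚ.+-comm 1ℚ (ℕ→ℚ n))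

  ℕ→ℚ-∸ : ∀ {m n} → n ℕ.≤ m → ℕ→ℚ (m ℕ.∸ n) ≡ ℕ→ℚ m - ℕ→ℚ n
  ℕ→ℚ-∸ {m} {n} n≤m = begin
    ℕ→ℚ (m ℕ.∸ n)                        ≡⟨ x≡x+y-y (ℕ→ℚ (m ℕ.∸ n)) (ℕ→ℚ n) ⟩
    (ℕ→ℚ (m ℕ.∸ n) + ℕ→ℚ n) - ℕ→ℚ n      ≡⟨ cong (_- ℕ→ℚ n) (ℕ→ℚ-+ (m ℕ.∸ n) n) ⟨
    ℕ→ℚ (m ℕ.∸ n ℕ.+ n) - ℕ→ℚ n          ≡⟨ cong (λ k → ℕ→ℚ k - ℕ→ℚ n) (ℕ.m∸n+n≡m n≤m) ⟩
    ℕ→ℚ m - ℕ→ℚ n                        ∎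
    where
    open ≡-Reasoning
    x≡x+y-y : ∀ x y → x ≡ x + y - y
    x≡x+y-y = solve-∀ ℚ-ring

  ℕ→ℚ-^ : ∀ m n → ℕ→ℚ (m ℕ.^ n) ≡ ℕ→ℚ m ^ n
  ℕ→ℚ-^ m zero = refl
  ℕ→ℚ-^ m (suc n) = trans (ℕ→ℚ-* m (m ℕ.^ n)) (trans (cong (ℕ→ℚ m *_) (ℕ→ℚ-^ m n)) (sym (^-homo-* (ℕ→ℚ m) 1 n)))

  ℕ→ℚ-double-^ : ∀ r j → ℕ→ℚ (r ℕ.+ r) ^ j ≡ 2 ^ j * ℕ→ℚ r ^ j
  ℕ→ℚ-double-^ r j = trans (cong (_^ j) (trans (ℕ→ℚ-+ r r) (double (ℕ→ℚ r)))) (^-distrib-* 2 (ℕ→ℚ r) j)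
    where
    double : ∀ x → x + x ≡ 2 * x
    double = solve-∀ ℚ-ring

  ^-even-neg : ∀ x j → (- x) ^ (j ℕ.+ j) ≡ x ^ (j ℕ.+ j)
  ^-even-neg x j = begin
    (- x) ^ (j ℕ.+ j)              ≡⟨ ^-homo-* (- x) j j ⟩
    (- x) ^ j * (- x) ^ j          ≡⟨ ^-distrib-* (- x) (- x) j ⟨
    (- x * - x) ^ j                ≡⟨ cong (_^ j) (neg*neg x) ⟩
    (x * x) ^ j                    ≡⟨ ^-distrib-* x x j ⟩
    x ^ j * x ^ j                  ≡⟨ ^-homo-* x j j ⟨
    x ^ (j ℕ.+ j)                  ∎
    where
    open ≡-Reasoning
    neg*neg : ∀ x → - x * - x ≡ x * x
    neg*neg = solve-∀ ℚ-ring

  i/n*n≡i : ∀ i n → (i / suc n) * ℕ→ℚ (suc n) ≡ ℤ→ℚ i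
  i/n*n≡i i n = ℚ.toℚᵘ-injective (begin
    toℚᵘ ((i / suc n) * ℕ→ℚ (suc n))           ≈⟨ ℚ.toℚᵘ-homo-* (i / suc n) (ℕ→ℚ (suc n)) ⟩
    toℚᵘ (i / suc n) ℚᵘ.* toℚᵘ (ℕ→ℚ (suc n))   ≈⟨ ℚᵘ.*-cong (toℚᵘ-/ i n) (toℚᵘ-ℤ→ℚ (ℤ.+ suc n)) ⟩
    ℚᵘ.mkℚᵘ i n ℚᵘ.* ℚᵘ.mkℚᵘ (ℤ.+ suc n) 0       ≈⟨ ℚᵘ.*≡* (cancel i (ℤ.+ suc n)) ⟩
    ℚᵘ.mkℚᵘ i 0                                ≈⟨ toℚᵘ-ℤ→ℚ i ⟨
    toℚᵘ (ℤ→ℚ i)                               ∎)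
    where
    open ℚᵘ.≃-Reasoning
    cancel : ∀ i d → (i ℤ.* d) ℤ.* ℤ.1ℤ ≡ i ℤ.* (d ℤ.* ℤ.1ℤ)
    cancel = ℤ.solve-∀

  inv : ℕ → ℚ
  inv zero    = 0ℚ
  inv (suc k) = ℤ.+ 1 / suc k

  inv-* : ∀ k → inv (suc k) * ℕ→ℚ (suc k) ≡ 1ℚ
  inv-* k = i/n*n≡i (ℤ.+ 1) k


  ∑< : ℕ → (ℕ → ℚ) → ℚ
  ∑< zero    f = 0ℚ
  ∑< (suc n) f = ∑< n f + f n

  infix 6.5 ∑<
  syntax ∑< n (λ i → x) = ∑[ i < n ] x

  ∑-cong : ∀ n {f g : ℕ → ℚ} → (∀ i → i ℕ.< n → f i ≡ g i) → ∑< n f ≡ ∑< n g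
  ∑-cong zero    f≡g = refl
  ∑-cong (suc n) f≡g = cong₂ _+_ (∑-cong n (λ i i<n → f≡g i (ℕ.m<n⇒m<1+n i<n))) (f≡g n ℕ.≤-refl)

  ∑-distrib-+ : ∀ n (f g : ℕ → ℚ) → ∑[ i < n ] (f i + g i) ≡ ∑< n f + ∑< n g
  ∑-distrib-+ zero    f g = refl
  ∑-distrib-+ (suc n) f g = trans (cong (_+ (f n + g n)) (∑-distrib-+ n f g))
                                  (+-interchange (∑< n f) (∑< n g) (f n) (g n))
    where
    +-interchange : ∀ a b c d → (a + b) + (c + d) ≡ (a + c) + (b + d)
    +-interchange = solve-∀ ℚ-ring

  ∑-distrib-minus : ∀ n (f g : ℕ → ℚ) → ∑[ i < n ] (f i - g i) ≡ ∑< n f - ∑< n g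
  ∑-distrib-minus zero    f g = refl
  ∑-distrib-minus (suc n) f g = trans (cong (_+ (f n - g n)) (∑-distrib-minus n f g))
                                  (regroup (∑< n f) (∑< n g) (f n) (g n))
    where
    regroup : ∀ a b c d → (a - b) + (c - d) ≡ (a + c) - (b + d)
    regroup = solve-∀ ℚ-ring

  *-distribˡ-∑ : ∀ n c (f : ℕ → ℚ) → c * ∑< n f ≡ ∑[ i < n ] (c * f i)
  *-distribˡ-∑ zero    c f = ℚ.*-zeroʳ c
  *-distribˡ-∑ (suc n) c f = trans (ℚ.*-distribˡ-+ c (∑< n f) (f n)) (cong (_+ c * f n) (*-distribˡ-∑ n c f))

  ∑-const : ∀ n c → ∑[ i < n ] c ≡ ℕ→ℚ n * c
  ∑-const zero    c = sym (ℚ.*-zeroˡ c)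
  ∑-const (suc n) c = begin
    ∑[ i < n ] c + c        ≡⟨ cong (_+ c) (∑-const n c) ⟩
    ℕ→ℚ n * c + c           ≡⟨ distrib (ℕ→ℚ n) c ⟩
    (ℕ→ℚ n + 1ℚ) * c        ≡⟨ cong (_* c) (ℕ→ℚ-suc n) ⟨
    ℕ→ℚ (suc n) * c         ∎
    where
    open ≡-Reasoning
    distrib : ∀ x c → x * c + c ≡ (x + 1ℚ) * c
    distrib = solve-∀ ℚ-ring

  ∑-shift : ∀ n (f : ℕ → ℚ) → ∑< (suc n) f ≡ f 0 + ∑[ i < n ] f (suc i)
  ∑-shift zero    f = ℚ.+-comm 0ℚ (f 0)
  ∑-shift (suc n) f = trans (cong (_+ f (suc n)) (∑-shift n f)) (ℚ.+-assoc (f 0) _ _)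

  ∑-split : ∀ m n (f : ℕ → ℚ) → ∑< (m ℕ.+ n) f ≡ ∑< m f + ∑[ i < n ] f (m ℕ.+ i)
  ∑-split m zero    f = trans (cong (λ k → ∑< k f) (ℕ.+-identityʳ m)) (sym (ℚ.+-identityʳ (∑< m f)))
  ∑-split m (suc n) f = begin
    ∑< (m ℕ.+ suc n) f                                  ≡⟨ cong (λ k → ∑< k f) (ℕ.+-suc m n) ⟩
    ∑< (m ℕ.+ n) f + f (m ℕ.+ n)                        ≡⟨ cong (_+ f (m ℕ.+ n)) (∑-split m n f) ⟩
    ∑< m f + ∑[ i < n ] f (m ℕ.+ i) + f (m ℕ.+ n)       ≡⟨ ℚ.+-assoc (∑< m f) _ _ ⟩
    ∑< m f + ∑[ i < suc n ] f (m ℕ.+ i)                 ∎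
    where open ≡-Reasoning

  ∑-blocks : ∀ k P (f : ℕ → ℚ) → ∑< (k ℕ.* P) f ≡ ∑[ a < k ] ∑[ r < P ] f (a ℕ.* P ℕ.+ r)
  ∑-blocks zero    P f = refl
  ∑-blocks (suc k) P f = begin
    ∑< (P ℕ.+ k ℕ.* P) f                                   ≡⟨ cong (λ n → ∑< n f) (ℕ.+-comm P (k ℕ.* P)) ⟩
    ∑< (k ℕ.* P ℕ.+ P) f                                   ≡⟨ ∑-split (k ℕ.* P) P f ⟩
    ∑< (k ℕ.* P) f + ∑[ r < P ] f (k ℕ.* P ℕ.+ r)          ≡⟨ cong (_+ ∑[ r < P ] f (k ℕ.* P ℕ.+ r)) (∑-blocks k P f) ⟩
    ∑[ a < suc k ] ∑[ r < P ] f (a ℕ.* P ℕ.+ r)            ∎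
    where open ≡-Reasoning

  ∑-comm : ∀ m n (f : ℕ → ℕ → ℚ) → ∑[ i < m ] ∑[ j < n ] f i j ≡ ∑[ j < n ] ∑[ i < m ] f i j
  ∑-comm zero    n f = sym (trans (∑-cong n (λ _ _ → refl)) (∑-zero n))
    where
    ∑-zero : ∀ n → ∑[ i < n ] 0ℚ ≡ 0ℚ
    ∑-zero n = trans (∑-const n 0ℚ) (ℚ.*-zeroʳ (ℕ→ℚ n))
  ∑-comm (suc m) n f = trans (cong (_+ ∑[ j < n ] f m j) (∑-comm m n f))
                             (sym (∑-distrib-+ n (λ j → ∑[ i < m ] f i j) (f m)))

  ∑-telescope : ∀ n (f : ℕ → ℚ) → ∑[ i < n ] (f (suc i) - f i) ≡ f n - f 0
  ∑-telescope zero    f = sym (ℚ.+-inverseʳ (f 0))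
  ∑-telescope (suc n) f = trans (cong (_+ (f (suc n) - f n)) (∑-telescope n f))
                                (collapse (f (suc n)) (f n) (f 0))
    where
    collapse : ∀ a b c → (b - c) + (a - b) ≡ a - c
    collapse = solve-∀ ℚ-ring

  ∑-reverse : ∀ n (f : ℕ → ℚ) → ∑< n f ≡ ∑[ i < n ] f (n ℕ.∸ suc i)
  ∑-reverse zero    f = refl
  ∑-reverse (suc n) f = begin
    ∑< n f + f n                                     ≡⟨ ℚ.+-comm (∑< n f) (f n) ⟩
    f n + ∑< n f                                     ≡⟨ cong (λ s → f n + s) (∑-reverse n f) ⟩
    f n + ∑[ i < n ] f (n ℕ.∸ suc i)                 ≡⟨ ∑-shift n (λ i → f (suc n ℕ.∸ suc i)) ⟨
    ∑[ i < suc n ] f (suc n ℕ.∸ suc i)               ∎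
    where open ≡-Reasoning

  ∑-reflect : ∀ n (f : ℕ → ℚ) → f 0 ≡ f n → ∑< n f ≡ ∑[ i < n ] f (n ℕ.∸ i)
  ∑-reflect zero    f _       = refl
  ∑-reflect (suc n) f f0≡fn = begin
    ∑< (suc n) f
      ≡⟨ ∑-shift n f ⟩
    f 0 + ∑[ i < n ] f (suc i)
      ≡⟨ cong₂ _+_ f0≡fn (∑-reverse n (f ∘ suc)) ⟩
    f (suc n) + ∑[ i < n ] f (suc (n ℕ.∸ suc i))
      ≡⟨ cong (λ s → f (suc n) + s) (∑-cong n (λ i i<n → cong f (sym (ℕ.+-∸-assoc 1 i<n)))) ⟩
    f (suc n) + ∑[ i < n ] f (n ℕ.∸ i)
      ≡⟨ ∑-shift n (λ i → f (suc n ℕ.∸ i)) ⟨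
    ∑[ i < suc n ] f (suc n ℕ.∸ i) ∎
    where open ≡-Reasoning

  r<h⇒r+r<P : ∀ {h P r} → h ℕ.+ h ≡ suc P → r ℕ.< h → r ℕ.+ r ℕ.< P
  r<h⇒r+r<P {h} {P} {r} h+h≡1+P r<h =
    subst (ℕ._≤ P) (ℕ.+-suc r r) (ℕ.≤-pred (subst (suc r ℕ.+ suc r ℕ.≤_) h+h≡1+P (ℕ.+-mono-≤ r<h r<h)))

  ∑-fold : ∀ n {P} (f : ℕ → ℚ) → n ℕ.+ n ≡ suc P → ∑< (suc P) f ≡ ∑[ r < n ] (f r + f (P ℕ.∸ r))
  ∑-fold n {P} f n+n≡1+P = begin
    ∑< (suc P) f
      ≡⟨ cong (λ k → ∑< k f) n+n≡1+P ⟨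
    ∑< (n ℕ.+ n) f
      ≡⟨ ∑-split n n f ⟩
    ∑< n f + ∑[ i < n ] f (n ℕ.+ i)
      ≡⟨ cong (λ s → ∑< n f + s) (∑-reverse n (λ i → f (n ℕ.+ i))) ⟩
    ∑< n f + ∑[ i < n ] f (n ℕ.+ (n ℕ.∸ suc i))
      ≡⟨ cong (λ s → ∑< n f + s) (∑-cong n (λ i i<n → cong f (reflected i<n))) ⟩
    ∑< n f + ∑[ i < n ] f (P ℕ.∸ i)
      ≡⟨ ∑-distrib-+ n f (λ r → f (P ℕ.∸ r)) ⟨
    ∑[ r < n ] (f r + f (P ℕ.∸ r)) ∎
    where
    open ≡-Reasoning
    reflected : ∀ {i} → i ℕ.< n → n ℕ.+ (n ℕ.∸ suc i) ≡ P ℕ.∸ i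
    reflected {i} i<n = trans (sym (ℕ.+-∸-assoc n i<n)) (cong (ℕ._∸ suc i) n+n≡1+P)

  ∑-evens+odds : ∀ n (f : ℕ → ℚ) → ∑< (n ℕ.+ n) f ≡ ∑[ r < n ] (f (r ℕ.+ r) + f (suc (r ℕ.+ r)))
  ∑-evens+odds zero    f = refl
  ∑-evens+odds (suc n) f = begin
    ∑< (suc n ℕ.+ suc n) f
      ≡⟨ cong (λ k → ∑< (suc k) f) (ℕ.+-suc n n) ⟩
    ∑< (n ℕ.+ n) f + f (n ℕ.+ n) + f (suc (n ℕ.+ n))
      ≡⟨ ℚ.+-assoc (∑< (n ℕ.+ n) f) _ _ ⟩
    ∑< (n ℕ.+ n) f + (f (n ℕ.+ n) + f (suc (n ℕ.+ n)))
      ≡⟨ cong (_+ (f (n ℕ.+ n) + f (suc (n ℕ.+ n)))) (∑-evens+odds n f) ⟩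
    ∑[ r < suc n ] (f (r ℕ.+ r) + f (suc (r ℕ.+ r))) ∎
    where open ≡-Reasoning

  ∑-fold-evens : ∀ n {P} (f : ℕ → ℚ) → n ℕ.+ n ≡ suc P → ∑< (suc P) f ≡ ∑[ r < n ] (f (r ℕ.+ r) + f (P ℕ.∸ (r ℕ.+ r)))
  ∑-fold-evens n {P} f n+n≡1+P = begin
    ∑< (suc P) f
      ≡⟨ cong (λ k → ∑< k f) n+n≡1+P ⟨
    ∑< (n ℕ.+ n) f
      ≡⟨ ∑-evens+odds n f ⟩
    ∑[ r < n ] (f (r ℕ.+ r) + f (suc (r ℕ.+ r)))
      ≡⟨ ∑-distrib-+ n _ _ ⟩
    ∑[ r < n ] f (r ℕ.+ r) + ∑[ r < n ] f (suc (r ℕ.+ r))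
      ≡⟨ cong (λ s → ∑[ r < n ] f (r ℕ.+ r) + s) (∑-reverse n _) ⟩
    ∑[ r < n ] f (r ℕ.+ r) + ∑[ i < n ] f (suc (n ℕ.∸ suc i ℕ.+ (n ℕ.∸ suc i)))
      ≡⟨ cong (λ s → ∑[ r < n ] f (r ℕ.+ r) + s) (∑-cong n (λ i i<n → cong f (odd-index i<n))) ⟩
    ∑[ r < n ] f (r ℕ.+ r) + ∑[ i < n ] f (P ℕ.∸ (i ℕ.+ i))
      ≡⟨ ∑-distrib-+ n _ _ ⟨
    ∑[ r < n ] (f (r ℕ.+ r) + f (P ℕ.∸ (r ℕ.+ r))) ∎
    where
    open ≡-Reasoning
    odd-index : ∀ {i} → i ℕ.< n → suc (n ℕ.∸ suc i ℕ.+ (n ℕ.∸ suc i)) ≡ P ℕ.∸ (i ℕ.+ i)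
    odd-index {i} i<n = begin
      suc (d ℕ.+ d)                                       ≡⟨ ℕ.m+n∸n≡m (suc (d ℕ.+ d)) (suc (i ℕ.+ i)) ⟨
      suc (d ℕ.+ d) ℕ.+ suc (i ℕ.+ i) ℕ.∸ suc (i ℕ.+ i)   ≡⟨ cong (ℕ._∸ suc (i ℕ.+ i)) (regroup d i) ⟩
      (suc i ℕ.+ d) ℕ.+ (suc i ℕ.+ d) ℕ.∸ suc (i ℕ.+ i)   ≡⟨ cong (λ m → m ℕ.+ m ℕ.∸ suc (i ℕ.+ i)) (ℕ.m+[n∸m]≡n i<n) ⟩
      n ℕ.+ n ℕ.∸ suc (i ℕ.+ i)                           ≡⟨ cong (ℕ._∸ suc (i ℕ.+ i)) n+n≡1+P ⟩
      P ℕ.∸ (i ℕ.+ i)                                     ∎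
      where
      d = n ℕ.∸ suc i
      regroup : ∀ d i → suc (d ℕ.+ d) ℕ.+ suc (i ℕ.+ i) ≡ (suc i ℕ.+ d) ℕ.+ (suc i ℕ.+ d)
      regroup = ℕ.solve-∀

  ∑-vanishing-tail : ∀ {m n} (f : ℕ → ℚ) → m ℕ.≤ n → (∀ i → m ℕ.≤ i → i ℕ.< n → f i ≡ 0ℚ) → ∑< n f ≡ ∑< m f
  ∑-vanishing-tail {m} f m≤n tail≡0 with ℕ.m≤n⇒∃[o]m+o≡n m≤n
  ... | k , refl = begin
    ∑< (m ℕ.+ k) f
      ≡⟨ ∑-split m k f ⟩
    ∑< m f + ∑[ i < k ] f (m ℕ.+ i)
      ≡⟨ cong (λ s → ∑< m f + s) (∑-cong k (λ i i<k → tail≡0 (m ℕ.+ i) (ℕ.m≤m+n m i) (ℕ.+-monoʳ-< m i<k))) ⟩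
    ∑< m f + ∑[ i < k ] 0ℚ
      ≡⟨ cong (λ s → ∑< m f + s) (trans (∑-const k 0ℚ) (ℚ.*-zeroʳ (ℕ→ℚ k))) ⟩
    ∑< m f + 0ℚ
      ≡⟨ ℚ.+-identityʳ (∑< m f) ⟩
    ∑< m f ∎
    where open ≡-Reasoning

  sumℚ-applyUpTo : ∀ n (f : ℕ → ℚ) g → sumℚ (map f (applyUpTo g n)) ≡ ∑[ i < n ] f (g i)
  sumℚ-applyUpTo zero    f g = refl
  sumℚ-applyUpTo (suc n) f g = trans (cong (λ s → f (g 0) + s) (sumℚ-applyUpTo n f (g ∘ suc))) (sym (∑-shift n (f ∘ g)))

  sumℚ-upTo : ∀ n (f : ℕ → ℚ) → sumℚ (map f (upTo n)) ≡ ∑< n f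
  sumℚ-upTo n f = sumℚ-applyUpTo n f (λ i → i)

  sumℚ-downFrom : ∀ n (f : ℕ → ℚ) → sumℚ (map f (downFrom n)) ≡ ∑< n f
  sumℚ-downFrom zero    f = refl
  sumℚ-downFrom (suc n) f = trans (cong (λ s → f n + s) (sumℚ-downFrom n f)) (ℚ.+-comm (f n) (∑< n f))


  -- Binomial coefficients, Bernoulli numbers and power sums

  binomial : ∀ n x → (x + 1ℚ) ^ n ≡ ∑[ j < suc n ] (ℕ→ℚ (n C j) * x ^ j)
  binomial zero    x = refl
  binomial (suc n) x = begin
    (x + 1ℚ) ^ suc n
      ≡⟨ ^-homo-* (x + 1ℚ) 1 n ⟩
    (x + 1ℚ) * (x + 1ℚ) ^ n
      ≡⟨ cong ((x + 1ℚ) *_) (binomial n x) ⟩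
    (x + 1ℚ) * ∑< (suc n) term
      ≡⟨ x+1*s≡1+[x*s+t] x (∑< (suc n) term) _ ∑term≡1+∑shifted ⟩
    1ℚ + (x * ∑< (suc n) term + ∑< (suc n) shifted)
      ≡⟨ cong (λ s → 1ℚ + (s + ∑< (suc n) shifted)) (*-distribˡ-∑ (suc n) x term) ⟩
    1ℚ + (∑[ j < suc n ] (x * term j) + ∑< (suc n) shifted)
      ≡⟨ cong (λ s → 1ℚ + s) (∑-distrib-+ (suc n) (λ j → x * term j) shifted) ⟨
    1ℚ + ∑[ j < suc n ] (x * term j + shifted j)
      ≡⟨ cong (λ s → 1ℚ + s) (∑-cong (suc n) (λ j _ → pascal j)) ⟩
    1ℚ + ∑[ j < suc n ] (ℕ→ℚ (suc n C suc j) * x ^ suc j)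
      ≡⟨ ∑-shift (suc n) (λ j → ℕ→ℚ (suc n C j) * x ^ j) ⟨
    ∑[ j < suc (suc n) ] (ℕ→ℚ (suc n C j) * x ^ j) ∎
    where
    open ≡-Reasoning
    term shifted : ℕ → ℚ
    term    j = ℕ→ℚ (n C j) * x ^ j
    shifted j = ℕ→ℚ (n C suc j) * x ^ suc j

    x+1*s≡1+[x*s+t] : ∀ x s t → s ≡ 1ℚ + t → (x + 1ℚ) * s ≡ 1ℚ + (x * s + t)
    x+1*s≡1+[x*s+t] x s t refl = solve (x ∷ t ∷ []) ℚ-ring

    last≡0 : shifted n ≡ 0ℚ
    last≡0 = trans (cong (λ c → ℕ→ℚ c * x ^ suc n) (k>n⇒nCk≡0 (ℕ.n<1+n n))) (ℚ.*-zeroˡ (x ^ suc n))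

    ∑term≡1+∑shifted : ∑< (suc n) term ≡ 1ℚ + ∑< (suc n) shifted
    ∑term≡1+∑shifted = begin
      ∑< (suc n) term                          ≡⟨ ∑-shift n term ⟩
      1ℚ + ∑< n shifted                        ≡⟨ cong (λ s → 1ℚ + s) (ℚ.+-identityʳ (∑< n shifted)) ⟨
      1ℚ + (∑< n shifted + 0ℚ)                 ≡⟨ cong (λ s → 1ℚ + (∑< n shifted + s)) last≡0 ⟨
      1ℚ + ∑< (suc n) shifted                  ∎

    pascal : ∀ j → x * term j + shifted j ≡ ℕ→ℚ (suc n C suc j) * x ^ suc j
    pascal j = begin
      x * (ℕ→ℚ (n C j) * x ^ j) + ℕ→ℚ (n C suc j) * x ^ suc j
        ≡⟨ cong (λ y → x * (ℕ→ℚ (n C j) * x ^ j) + ℕ→ℚ (n C suc j) * y) (^-homo-* x 1 j) ⟩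
      x * (ℕ→ℚ (n C j) * x ^ j) + ℕ→ℚ (n C suc j) * (x * x ^ j)
        ≡⟨ collect x (ℕ→ℚ (n C j)) (ℕ→ℚ (n C suc j)) (x ^ j) ⟩
      (ℕ→ℚ (n C j) + ℕ→ℚ (n C suc j)) * (x * x ^ j)
        ≡⟨ cong₂ _*_ (trans (sym (ℕ→ℚ-+ (n C j) (n C suc j))) (cong ℕ→ℚ (nCk+nC[k+1]≡[n+1]C[k+1] n j)))
                     (sym (^-homo-* x 1 j)) ⟩
      ℕ→ℚ (suc n C suc j) * x ^ suc j ∎
      where
      collect : ∀ x a b y → x * (a * y) + b * (x * y) ≡ (a + b) * (x * y)
      collect = solve-∀ ℚ-ring

  [2+n]C[1+n]≡2+n : ∀ n → suc (suc n) C suc n ≡ suc (suc n)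
  [2+n]C[1+n]≡2+n n = trans (nCk≡nC[n∸k] (ℕ.n≤1+n (suc n)))
                            (trans (cong (suc (suc n) C_) (ℕ.m+n∸n≡m 1 (suc n))) (nC1≡n (suc (suc n))))

  binomial-sum-last : ∀ k (f : ℕ → ℚ) →
    ∑[ j < suc (suc k) ] (ℕ→ℚ (suc (suc k) C j) * f j) + - (∑[ j < suc k ] (ℕ→ℚ (suc (suc k) C j) * f j))
    ≡ ℕ→ℚ (suc (suc k)) * f (suc k)
  binomial-sum-last k f = trans (cancel (∑[ j < suc k ] (ℕ→ℚ (suc (suc k) C j) * f j)) _)
                                (cong (λ c → ℕ→ℚ c * f (suc k)) ([2+n]C[1+n]≡2+n k))
    where
    cancel : ∀ s t → s + t + - s ≡ t
    cancel = solve-∀ ℚ-ring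

  binomial-ends : ∀ n x → (x + 1ℚ) ^ suc n ≡ 1ℚ + ∑[ j < n ] (ℕ→ℚ (suc n C suc j) * x ^ suc j) + x ^ suc n
  binomial-ends n x = begin
    (x + 1ℚ) ^ suc n
      ≡⟨ binomial (suc n) x ⟩
    ∑[ j < suc n ] (ℕ→ℚ (suc n C j) * x ^ j) + ℕ→ℚ (suc n C suc n) * x ^ suc n
      ≡⟨ cong₂ _+_ (∑-shift n _) (cong (λ c → ℕ→ℚ c * x ^ suc n) (nCn≡1 (suc n))) ⟩
    1ℚ + ∑[ j < n ] (ℕ→ℚ (suc n C suc j) * x ^ suc j) + 1ℚ * x ^ suc n
      ≡⟨ cong (λ s → 1ℚ + ∑[ j < n ] (ℕ→ℚ (suc n C suc j) * x ^ suc j) + s) (ℚ.*-identityˡ (x ^ suc n)) ⟩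
    1ℚ + ∑[ j < n ] (ℕ→ℚ (suc n C suc j) * x ^ suc j) + x ^ suc n ∎
    where open ≡-Reasoning

  bernRev≡map-B : ∀ n → bernRev n ≡ map B (downFrom (suc n))
  bernRev≡map-B zero    = refl
  bernRev≡map-B (suc n) = cong (B (suc n) ∷_) (bernRev≡map-B n)

  B-recurrence : ∀ n → ∑[ j < suc (suc n) ] (ℕ→ℚ (suc (suc n) C j) * B j) ≡ 0ℚ
  B-recurrence n = begin
    T + ℕ→ℚ (N C suc n) * B (suc n)
      ≡⟨ cong₂ (λ c t → T + ℕ→ℚ c * - (inv N * t)) ([2+n]C[1+n]≡2+n n) defining-sum ⟩
    T + ℕ→ℚ N * - (inv N * T)
      ≡⟨ cancel T (ℕ→ℚ N) (inv N) ⟩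
    T - (inv N * ℕ→ℚ N) * T
      ≡⟨ cong (λ c → T - c * T) (inv-* (suc n)) ⟩
    T - 1ℚ * T
      ≡⟨ cong (λ s → T - s) (ℚ.*-identityˡ T) ⟩
    T - T
      ≡⟨ ℚ.+-inverseʳ T ⟩
    0ℚ ∎
    where
    open ≡-Reasoning
    N = suc (suc n)
    T = ∑[ j < suc n ] (ℕ→ℚ (N C j) * B j)

    zipWith-map : ∀ m (g : ℕ → ℚ → ℚ) → zipWith g (downFrom m) (map B (downFrom m)) ≡ map (λ j → g j (B j)) (downFrom m)
    zipWith-map zero    g = refl
    zipWith-map (suc m) g = cong (g m (B m) ∷_) (zipWith-map m g)

    defining-sum : sumℚ (zipWith (λ j b → ℕ→ℚ (N C j) * b) (downFrom (suc n)) (bernRev n)) ≡ T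
    defining-sum = begin
      sumℚ (zipWith (λ j b → ℕ→ℚ (N C j) * b) (downFrom (suc n)) (bernRev n))
        ≡⟨ cong (λ bs → sumℚ (zipWith (λ j b → ℕ→ℚ (N C j) * b) (downFrom (suc n)) bs)) (bernRev≡map-B n) ⟩
      sumℚ (zipWith (λ j b → ℕ→ℚ (N C j) * b) (downFrom (suc n)) (map B (downFrom (suc n))))
        ≡⟨ cong sumℚ (zipWith-map (suc n) (λ j b → ℕ→ℚ (N C j) * b)) ⟩
      sumℚ (map (λ j → ℕ→ℚ (N C j) * B j) (downFrom (suc n)))
        ≡⟨ sumℚ-downFrom (suc n) _ ⟩
      T ∎

    cancel : ∀ t x y → t + x * - (y * t) ≡ t - (y * x) * t
    cancel = solve-∀ ℚ-ring

  powerSum : ℕ → ℕ → ℚ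
  powerSum n j = ∑[ r < n ] ℕ→ℚ r ^ j

  ∑-binomial-powerSum : ∀ n k → ∑[ j < suc k ] (ℕ→ℚ (suc k C j) * powerSum n j) ≡ ℕ→ℚ n ^ suc k
  ∑-binomial-powerSum n k = begin
    ∑[ j < suc k ] (ℕ→ℚ (suc k C j) * powerSum n j)
      ≡⟨ ∑-cong (suc k) (λ j _ → *-distribˡ-∑ n (ℕ→ℚ (suc k C j)) _) ⟩
    ∑[ j < suc k ] ∑[ r < n ] (ℕ→ℚ (suc k C j) * ℕ→ℚ r ^ j)
      ≡⟨ ∑-comm (suc k) n _ ⟩
    ∑[ r < n ] ∑[ j < suc k ] (ℕ→ℚ (suc k C j) * ℕ→ℚ r ^ j)
      ≡⟨ ∑-cong n (λ r _ → consecutive-powers r) ⟩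
    ∑[ r < n ] (ℕ→ℚ (suc r) ^ suc k - ℕ→ℚ r ^ suc k)
      ≡⟨ ∑-telescope n (λ r → ℕ→ℚ r ^ suc k) ⟩
    ℕ→ℚ n ^ suc k - 0ℚ ^ suc k
      ≡⟨ cong (λ z → ℕ→ℚ n ^ suc k - z) (trans (^-homo-* 0ℚ 1 k) (ℚ.*-zeroˡ (0ℚ ^ k))) ⟩
    ℕ→ℚ n ^ suc k - 0ℚ
      ≡⟨ ℚ.+-identityʳ (ℕ→ℚ n ^ suc k) ⟩
    ℕ→ℚ n ^ suc k ∎
    where
    open ≡-Reasoning
    consecutive-powers : ∀ r → ∑[ j < suc k ] (ℕ→ℚ (suc k C j) * ℕ→ℚ r ^ j) ≡ ℕ→ℚ (suc r) ^ suc k - ℕ→ℚ r ^ suc k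
    consecutive-powers r = begin
      S
        ≡⟨ x≡x+y-y S (ℕ→ℚ r ^ suc k) ⟩
      S + 1ℚ * ℕ→ℚ r ^ suc k - ℕ→ℚ r ^ suc k
        ≡⟨ cong (λ c → S + ℕ→ℚ c * ℕ→ℚ r ^ suc k - ℕ→ℚ r ^ suc k) (nCn≡1 (suc k)) ⟨
      ∑[ j < suc (suc k) ] (ℕ→ℚ (suc k C j) * ℕ→ℚ r ^ j) - ℕ→ℚ r ^ suc k
        ≡⟨ cong (_- ℕ→ℚ r ^ suc k) (binomial (suc k) (ℕ→ℚ r)) ⟨
      (ℕ→ℚ r + 1ℚ) ^ suc k - ℕ→ℚ r ^ suc k
        ≡⟨ cong (λ x → x ^ suc k - ℕ→ℚ r ^ suc k) (ℕ→ℚ-suc r) ⟨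
      ℕ→ℚ (suc r) ^ suc k - ℕ→ℚ r ^ suc k ∎
      where
      S = ∑[ j < suc k ] (ℕ→ℚ (suc k C j) * ℕ→ℚ r ^ j)
      x≡x+y-y : ∀ x y → x ≡ x + 1ℚ * y - y
      x≡x+y-y = solve-∀ ℚ-ring

  ∑-quadratic : ∀ n c x y → ∑[ a < n ] (c - x * ℕ→ℚ a + y * ℕ→ℚ a ^ 2) ≡ ℕ→ℚ n * c - x * powerSum n 1 + y * powerSum n 2
  ∑-quadratic n c x y = begin
    ∑[ a < n ] (c - x * ℕ→ℚ a + y * ℕ→ℚ a ^ 2)
      ≡⟨ ∑-distrib-+ n _ _ ⟩
    ∑[ a < n ] (c - x * ℕ→ℚ a) + ∑[ a < n ] (y * ℕ→ℚ a ^ 2)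
      ≡⟨ cong (_+ ∑[ a < n ] (y * ℕ→ℚ a ^ 2)) (∑-distrib-minus n _ _) ⟩
    ∑[ a < n ] c - ∑[ a < n ] (x * ℕ→ℚ a) + ∑[ a < n ] (y * ℕ→ℚ a ^ 2)
      ≡⟨ cong₂ (λ s t → ∑[ a < n ] c - s + t) (*-distribˡ-∑ n x ℕ→ℚ) (*-distribˡ-∑ n y (λ a → ℕ→ℚ a ^ 2)) ⟨
    ∑[ a < n ] c - x * powerSum n 1 + y * powerSum n 2
      ≡⟨ cong (λ s → s - x * powerSum n 1 + y * powerSum n 2) (∑-const n c) ⟩
    ℕ→ℚ n * c - x * powerSum n 1 + y * powerSum n 2 ∎
    where open ≡-Reasoning

  -- Inverses of shifted arguments

  inverse-shift : ∀ {a b x δ} → a * x ≡ 1ℚ → b * (δ + x) ≡ 1ℚ → a ≡ b * (1ℚ + δ * a)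
  inverse-shift {a} {b} {x} {δ} ax≡1 b[δ+x]≡1 = begin
    a                               ≡⟨ ℚ.*-identityʳ a ⟨
    a * 1ℚ                          ≡⟨ cong (a *_) b[δ+x]≡1 ⟨
    a * (b * (δ + x))               ≡⟨ expand a b x δ ⟩
    b * (a * x) + b * (δ * a)       ≡⟨ cong (λ y → b * y + b * (δ * a)) ax≡1 ⟩
    b * 1ℚ + b * (δ * a)            ≡⟨ ℚ.*-distribˡ-+ b 1ℚ (δ * a) ⟨
    b * (1ℚ + δ * a)                ∎
    where
    open ≡-Reasoning
    expand : ∀ a b x δ → a * (b * (δ + x)) ≡ b * (a * x) + b * (δ * a)
    expand = solve-∀ ℚ-ring

  inverse²-error : ∀ {a b δ} → a ≡ b * (1ℚ + δ * a) →
    b ^ 2 - (a ^ 2 - 2 * δ * a ^ 3 + 3 * δ ^ 2 * a ^ 4) ≡ - (a ^ 3 * (4 + 3 * δ * a) * b ^ 2) * δ ^ 3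
  inverse²-error {a} {b} {δ} a≡ = begin
    b ^ 2 - (a ^ 2 - 2 * δ * a ^ 3 + 3 * δ ^ 2 * a ^ 4)
      ≡⟨ factor a b δ ⟩
    b ^ 2 - a ^ 2 * (1ℚ - 2 * (δ * a) + 3 * (δ * a) ^ 2)
      ≡⟨ cong (λ y → b ^ 2 - y ^ 2 * (1ℚ - 2 * (δ * a) + 3 * (δ * a) ^ 2)) a≡ ⟩
    b ^ 2 - (b * (1ℚ + δ * a)) ^ 2 * (1ℚ - 2 * (δ * a) + 3 * (δ * a) ^ 2)
      ≡⟨ collapse a b δ ⟩
    - (a ^ 3 * (4 + 3 * δ * a) * b ^ 2) * δ ^ 3 ∎
    where
    open ≡-Reasoning
    factor : ∀ a b δ → b ^ 2 - (a ^ 2 - 2 * δ * a ^ 3 + 3 * δ ^ 2 * a ^ 4)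
                     ≡ b ^ 2 - a ^ 2 * (1ℚ - 2 * (δ * a) + 3 * (δ * a) ^ 2)
    factor = solve-∀ ℚ-ring
    collapse : ∀ a b δ → b ^ 2 - (b * (1ℚ + δ * a)) ^ 2 * (1ℚ - 2 * (δ * a) + 3 * (δ * a) ^ 2)
                       ≡ - (a ^ 3 * (4 + 3 * δ * a) * b ^ 2) * δ ^ 3
    collapse = solve-∀ ℚ-ring

  inverse³-error : ∀ {a b δ} → a ≡ b * (1ℚ + δ * a) → b ^ 3 - a ^ 3 ≡ - (a * b ^ 3 * (3 + 3 * δ * a + (δ * a) ^ 2)) * δ
  inverse³-error {a} {b} {δ} a≡ = begin
    b ^ 3 - a ^ 3                          ≡⟨ cong (λ y → b ^ 3 - y ^ 3) a≡ ⟩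
    b ^ 3 - (b * (1ℚ + δ * a)) ^ 3         ≡⟨ collapse a b δ ⟩
    - (a * b ^ 3 * (3 + 3 * δ * a + (δ * a) ^ 2)) * δ  ∎
    where
    open ≡-Reasoning
    collapse : ∀ a b δ → b ^ 3 - (b * (1ℚ + δ * a)) ^ 3 ≡ - (a * b ^ 3 * (3 + 3 * δ * a + (δ * a) ^ 2)) * δ
    collapse = solve-∀ ℚ-ring

  -- Divisibility by powers of p in ℤ₍ₚ₎

  module PAdic {p : ℕ} (p-prime : Prime p) where

    p∤1 : ¬ p ∣ 1
    p∤1 p∣1 = ¬prime[1] (subst Prime (∣1⇒≡1 p∣1) p-prime)

    p∤* : ∀ {m n} → ¬ p ∣ m → ¬ p ∣ n → ¬ p ∣ m ℕ.* n
    p∤* {m} {n} p∤m p∤n p∣mn with euclidsLemma m n p-prime p∣mn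
    ... | inj₁ p∣m = p∤m p∣m
    ... | inj₂ p∣n = p∤n p∣n

    infix 4 p^[_]∣_
    record p^[_]∣_ (e : ℕ) (x : ℚ) : Set where
      constructor mk∣
      field
        u   : ℤ
        v   : ℕ
        p∤v : ¬ p ∣ v
        x*v≡p^e*u : x * ℕ→ℚ v ≡ ℕ→ℚ (p ℕ.^ e) * ℤ→ℚ u

    ∣-zero : ∀ {e} → p^[ e ]∣ 0ℚ
    ∣-zero {e} = mk∣ (ℤ.+ 0) 1 p∤1 (trans (ℚ.*-zeroˡ 1ℚ) (sym (ℚ.*-zeroʳ (ℕ→ℚ (p ℕ.^ e)))))

    ∣-ℤ : ∀ u → p^[ 0 ]∣ ℤ→ℚ u
    ∣-ℤ u = mk∣ u 1 p∤1 (trans (ℚ.*-identityʳ (ℤ→ℚ u)) (sym (ℚ.*-identityˡ (ℤ→ℚ u))))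

    ∣-ℕ : ∀ n → p^[ 0 ]∣ ℕ→ℚ n
    ∣-ℕ n = ∣-ℤ (ℤ.+ n)

    ∣-ℕ-multiple : ∀ {e n} → p ℕ.^ e ∣ n → p^[ e ]∣ ℕ→ℚ n
    ∣-ℕ-multiple {e} (divides q refl) =
      mk∣ (ℤ.+ q) 1 p∤1 (trans (ℚ.*-identityʳ _) (trans (ℕ→ℚ-* q (p ℕ.^ e)) (ℚ.*-comm (ℕ→ℚ q) _)))

    ∣-p^ : ∀ e → p^[ e ]∣ ℕ→ℚ (p ℕ.^ e)
    ∣-p^ e = ∣-ℕ-multiple ∣-refl

    ∣-+ : ∀ {e x y} → p^[ e ]∣ x → p^[ e ]∣ y → p^[ e ]∣ (x + y)
    ∣-+ {e} {x} {y} (mk∣ u v p∤v xv≡) (mk∣ u′ v′ p∤v′ yv′≡) =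
      mk∣ (u ℤ.* ℤ.+ v′ ℤ.+ u′ ℤ.* ℤ.+ v) (v ℕ.* v′) (p∤* p∤v p∤v′) (begin
        (x + y) * ℕ→ℚ (v ℕ.* v′)
          ≡⟨ cong ((x + y) *_) (ℕ→ℚ-* v v′) ⟩
        (x + y) * (ℕ→ℚ v * ℕ→ℚ v′)
          ≡⟨ expand x y (ℕ→ℚ v) (ℕ→ℚ v′) ⟩
        x * ℕ→ℚ v * ℕ→ℚ v′ + y * ℕ→ℚ v′ * ℕ→ℚ v
          ≡⟨ cong₂ (λ s t → s * ℕ→ℚ v′ + t * ℕ→ℚ v) xv≡ yv′≡ ⟩
        P * U * ℕ→ℚ v′ + P * U′ * ℕ→ℚ v
          ≡⟨ factor P U U′ (ℕ→ℚ v) (ℕ→ℚ v′) ⟩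
        P * (U * ℕ→ℚ v′ + U′ * ℕ→ℚ v)
          ≡⟨ cong (P *_) (cong₂ _+_ (ℤ→ℚ-* u (ℤ.+ v′)) (ℤ→ℚ-* u′ (ℤ.+ v))) ⟨
        P * (ℤ→ℚ (u ℤ.* ℤ.+ v′) + ℤ→ℚ (u′ ℤ.* ℤ.+ v))
          ≡⟨ cong (P *_) (ℤ→ℚ-+ (u ℤ.* ℤ.+ v′) (u′ ℤ.* ℤ.+ v)) ⟨
        P * ℤ→ℚ (u ℤ.* ℤ.+ v′ ℤ.+ u′ ℤ.* ℤ.+ v) ∎)
      where
      open ≡-Reasoning
      P = ℕ→ℚ (p ℕ.^ e)
      U = ℤ→ℚ u
      U′ = ℤ→ℚ u′
      expand : ∀ x y a b → (x + y) * (a * b) ≡ x * a * b + y * b * a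
      expand = solve-∀ ℚ-ring
      factor : ∀ P U U′ a b → P * U * b + P * U′ * a ≡ P * (U * b + U′ * a)
      factor = solve-∀ ℚ-ring

    ∣-neg : ∀ {e x} → p^[ e ]∣ x → p^[ e ]∣ (- x)
    ∣-neg {e} {x} (mk∣ u v p∤v xv≡) = mk∣ (ℤ.- u) v p∤v (begin
      - x * ℕ→ℚ v                         ≡⟨ ℚ.neg-distribˡ-* x (ℕ→ℚ v) ⟨
      - (x * ℕ→ℚ v)                       ≡⟨ cong -_ xv≡ ⟩
      - (ℕ→ℚ (p ℕ.^ e) * ℤ→ℚ u)           ≡⟨ ℚ.neg-distribʳ-* (ℕ→ℚ (p ℕ.^ e)) (ℤ→ℚ u) ⟩
      ℕ→ℚ (p ℕ.^ e) * - ℤ→ℚ u             ≡⟨ cong (ℕ→ℚ (p ℕ.^ e) *_) (ℤ→ℚ-neg u) ⟨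
      ℕ→ℚ (p ℕ.^ e) * ℤ→ℚ (ℤ.- u)         ∎)
      where open ≡-Reasoning

    ∣-* : ∀ {a b x y} → p^[ a ]∣ x → p^[ b ]∣ y → p^[ a ℕ.+ b ]∣ (x * y)
    ∣-* {a} {b} {x} {y} (mk∣ u v p∤v xv≡) (mk∣ u′ v′ p∤v′ yv′≡) =
      mk∣ (u ℤ.* u′) (v ℕ.* v′) (p∤* p∤v p∤v′) (begin
        x * y * ℕ→ℚ (v ℕ.* v′)                   ≡⟨ cong (x * y *_) (ℕ→ℚ-* v v′) ⟩
        x * y * (ℕ→ℚ v * ℕ→ℚ v′)                 ≡⟨ interchange x y (ℕ→ℚ v) (ℕ→ℚ v′) ⟩
        x * ℕ→ℚ v * (y * ℕ→ℚ v′)                 ≡⟨ cong₂ _*_ xv≡ yv′≡ ⟩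
        Pa * ℤ→ℚ u * (Pb * ℤ→ℚ u′)               ≡⟨ interchange Pa (ℤ→ℚ u) Pb (ℤ→ℚ u′) ⟩
        Pa * Pb * (ℤ→ℚ u * ℤ→ℚ u′)               ≡⟨ cong₂ _*_ (ℕ→ℚ-* (p ℕ.^ a) (p ℕ.^ b)) (ℤ→ℚ-* u u′) ⟨
        ℕ→ℚ (p ℕ.^ a ℕ.* p ℕ.^ b) * ℤ→ℚ (u ℤ.* u′)  ≡⟨ cong (λ n → ℕ→ℚ n * ℤ→ℚ (u ℤ.* u′)) (ℕ.^-distribˡ-+-* p a b) ⟨
        ℕ→ℚ (p ℕ.^ (a ℕ.+ b)) * ℤ→ℚ (u ℤ.* u′)   ∎)
      where
      open ≡-Reasoning
      Pa = ℕ→ℚ (p ℕ.^ a)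
      Pb = ℕ→ℚ (p ℕ.^ b)
      interchange : ∀ w x y z → w * x * (y * z) ≡ w * y * (x * z)
      interchange = solve-∀ ℚ-ring

    ∣-^ : ∀ {x} → p^[ 0 ]∣ x → ∀ n → p^[ 0 ]∣ x ^ n
    ∣-^ x∣ zero    = ∣-ℕ 1
    ∣-^ {x} x∣ (suc n) = subst (p^[ 0 ]∣_) (sym (^-homo-* x 1 n)) (∣-* x∣ (∣-^ x∣ n))

    ∣-*ʳ : ∀ {e x y} → p^[ e ]∣ x → p^[ 0 ]∣ y → p^[ e ]∣ (x * y)
    ∣-*ʳ {e} x∣ y∣ = subst (p^[_]∣ _) (ℕ.+-identityʳ e) (∣-* x∣ y∣)

    ∣-weaken : ∀ {a b x} → b ℕ.≤ a → p^[ a ]∣ x → p^[ b ]∣ x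
    ∣-weaken {a} {b} {x} b≤a (mk∣ u v p∤v xv≡) = mk∣ (ℤ.+ (p ℕ.^ (a ℕ.∸ b)) ℤ.* u) v p∤v (begin
      x * ℕ→ℚ v
        ≡⟨ xv≡ ⟩
      ℕ→ℚ (p ℕ.^ a) * ℤ→ℚ u
        ≡⟨ cong (λ e → ℕ→ℚ (p ℕ.^ e) * ℤ→ℚ u) (ℕ.m+[n∸m]≡n b≤a) ⟨
      ℕ→ℚ (p ℕ.^ (b ℕ.+ (a ℕ.∸ b))) * ℤ→ℚ u
        ≡⟨ cong (λ n → ℕ→ℚ n * ℤ→ℚ u) (ℕ.^-distribˡ-+-* p b (a ℕ.∸ b)) ⟩
      ℕ→ℚ (p ℕ.^ b ℕ.* p ℕ.^ (a ℕ.∸ b)) * ℤ→ℚ u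
        ≡⟨ cong (_* ℤ→ℚ u) (ℕ→ℚ-* (p ℕ.^ b) (p ℕ.^ (a ℕ.∸ b))) ⟩
      ℕ→ℚ (p ℕ.^ b) * ℕ→ℚ (p ℕ.^ (a ℕ.∸ b)) * ℤ→ℚ u
        ≡⟨ ℚ.*-assoc (ℕ→ℚ (p ℕ.^ b)) _ _ ⟩
      ℕ→ℚ (p ℕ.^ b) * (ℕ→ℚ (p ℕ.^ (a ℕ.∸ b)) * ℤ→ℚ u)
        ≡⟨ cong (ℕ→ℚ (p ℕ.^ b) *_) (ℤ→ℚ-* (ℤ.+ (p ℕ.^ (a ℕ.∸ b))) u) ⟨
      ℕ→ℚ (p ℕ.^ b) * ℤ→ℚ (ℤ.+ (p ℕ.^ (a ℕ.∸ b)) ℤ.* u) ∎)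
      where open ≡-Reasoning

    ∣-cancelˡ : ∀ {e x} c → ¬ p ∣ c → p^[ e ]∣ (ℕ→ℚ c * x) → p^[ e ]∣ x
    ∣-cancelˡ {e} {x} c p∤c (mk∣ u v p∤v cxv≡) = mk∣ u (c ℕ.* v) (p∤* p∤c p∤v) (begin
      x * ℕ→ℚ (c ℕ.* v)              ≡⟨ cong (x *_) (ℕ→ℚ-* c v) ⟩
      x * (ℕ→ℚ c * ℕ→ℚ v)            ≡⟨ reassoc x (ℕ→ℚ c) (ℕ→ℚ v) ⟩
      ℕ→ℚ c * x * ℕ→ℚ v              ≡⟨ cxv≡ ⟩
      ℕ→ℚ (p ℕ.^ e) * ℤ→ℚ u          ∎)
      where
      open ≡-Reasoning
      reassoc : ∀ x c v → x * (c * v) ≡ c * x * v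
      reassoc = solve-∀ ℚ-ring

    ∣-inv : ∀ {k} → ¬ p ∣ k → p^[ 0 ]∣ inv k
    ∣-inv {zero}  p∤0 = ⊥-elim (p∤0 (divides 0 refl))
    ∣-inv {suc k} p∤k = mk∣ (ℤ.+ 1) (suc k) p∤k (inv-* k)

    ∣-∑ : ∀ {e} n {f : ℕ → ℚ} → (∀ i → i ℕ.< n → p^[ e ]∣ f i) → p^[ e ]∣ ∑< n f
    ∣-∑ zero    f∣ = ∣-zero
    ∣-∑ (suc n) f∣ = ∣-+ (∣-∑ n (λ i i<n → f∣ i (ℕ.m<n⇒m<1+n i<n))) (f∣ n ℕ.≤-refl)

    infix 4 _≡_[p^_]
    record _≡_[p^_] (x y : ℚ) (e : ℕ) : Set where
      constructor mk≡ₚ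
      field
        difference-∣ : p^[ e ]∣ (x - y)

    open _≡_[p^_] public

    ≡ₚ-reflexive : ∀ {e x y} → x ≡ y → x ≡ y [p^ e ]
    ≡ₚ-reflexive {x = x} refl = mk≡ₚ (subst (p^[ _ ]∣_) (sym (ℚ.+-inverseʳ x)) ∣-zero)

    ≡ₚ-refl : ∀ {e x} → x ≡ x [p^ e ]
    ≡ₚ-refl = ≡ₚ-reflexive refl

    ≡ₚ-sym : ∀ {e x y} → x ≡ y [p^ e ] → y ≡ x [p^ e ]
    ≡ₚ-sym {x = x} {y} (mk≡ₚ x-y∣) = mk≡ₚ (subst (p^[ _ ]∣_) (negate x y) (∣-neg x-y∣))
      where
      negate : ∀ x y → - (x - y) ≡ y - x
      negate = solve-∀ ℚ-ring

    ≡ₚ-trans : ∀ {e x y z} → x ≡ y [p^ e ] → y ≡ z [p^ e ] → x ≡ z [p^ e ]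
    ≡ₚ-trans {x = x} {y} {z} (mk≡ₚ x-y∣) (mk≡ₚ y-z∣) = mk≡ₚ (subst (p^[ _ ]∣_) (add x y z) (∣-+ x-y∣ y-z∣))
      where
      add : ∀ x y z → (x - y) + (y - z) ≡ x - z
      add = solve-∀ ℚ-ring

    ≡ₚ-setoid : ℕ → Setoid _ _
    ≡ₚ-setoid e = record
      { Carrier = ℚ
      ; _≈_ = λ x y → x ≡ y [p^ e ]
      ; isEquivalence = record { refl = ≡ₚ-refl ; sym = ≡ₚ-sym ; trans = ≡ₚ-trans }
      }

    module ≡ₚ-Reasoning (e : ℕ) = SetoidReasoning (≡ₚ-setoid e)

    ∣⇒≡0 : ∀ {e x} → p^[ e ]∣ x → x ≡ 0ℚ [p^ e ]
    ∣⇒≡0 {x = x} x∣ = mk≡ₚ (subst (p^[ _ ]∣_) (sym (ℚ.+-identityʳ x)) x∣)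

    ≡0⇒∣ : ∀ {e x} → x ≡ 0ℚ [p^ e ] → p^[ e ]∣ x
    ≡0⇒∣ {x = x} (mk≡ₚ x-0∣) = subst (p^[ _ ]∣_) (ℚ.+-identityʳ x) x-0∣

    ≡ₚ-weaken : ∀ {a b x y} → b ℕ.≤ a → x ≡ y [p^ a ] → x ≡ y [p^ b ]
    ≡ₚ-weaken b≤a (mk≡ₚ x-y∣) = mk≡ₚ (∣-weaken b≤a x-y∣)

    +-congₚ : ∀ {e x x′ y y′} → x ≡ x′ [p^ e ] → y ≡ y′ [p^ e ] → x + y ≡ x′ + y′ [p^ e ]
    +-congₚ {x = x} {x′} {y} {y′} (mk≡ₚ x∣) (mk≡ₚ y∣) = mk≡ₚ (subst (p^[ _ ]∣_) (regroup x x′ y y′) (∣-+ x∣ y∣))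
      where
      regroup : ∀ x x′ y y′ → (x - x′) + (y - y′) ≡ (x + y) - (x′ + y′)
      regroup = solve-∀ ℚ-ring

    +-congˡₚ : ∀ {e} x {y y′} → y ≡ y′ [p^ e ] → x + y ≡ x + y′ [p^ e ]
    +-congˡₚ x = +-congₚ (≡ₚ-refl {x = x})

    +-congʳₚ : ∀ {e x x′} y → x ≡ x′ [p^ e ] → x + y ≡ x′ + y [p^ e ]
    +-congʳₚ y x≡x′ = +-congₚ x≡x′ (≡ₚ-refl {x = y})

    neg-congₚ : ∀ {e x y} → x ≡ y [p^ e ] → - x ≡ - y [p^ e ]
    neg-congₚ {x = x} {y} (mk≡ₚ x-y∣) = mk≡ₚ (subst (p^[ _ ]∣_) (regroup x y) (∣-neg x-y∣))
      where
      regroup : ∀ x y → - (x - y) ≡ - x - - y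
      regroup = solve-∀ ℚ-ring

    *-congˡₚ : ∀ {e c x y} → p^[ 0 ]∣ c → x ≡ y [p^ e ] → c * x ≡ c * y [p^ e ]
    *-congˡₚ {c = c} {x} {y} c∣ (mk≡ₚ x-y∣) = mk≡ₚ (subst (p^[ _ ]∣_) (distrib c x y) (∣-* c∣ x-y∣))
      where
      distrib : ∀ c x y → c * (x - y) ≡ c * x - c * y
      distrib = solve-∀ ℚ-ring

    ∑-congₚ : ∀ {e} n {f g : ℕ → ℚ} → (∀ i → i ℕ.< n → f i ≡ g i [p^ e ]) → ∑< n f ≡ ∑< n g [p^ e ]
    ∑-congₚ zero    f≡g = ≡ₚ-refl
    ∑-congₚ (suc n) f≡g = +-congₚ (∑-congₚ n (λ i i<n → f≡g i (ℕ.m<n⇒m<1+n i<n))) (f≡g n ℕ.≤-refl)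

    cancelˡₚ : ∀ {e x y} c → ¬ p ∣ c → ℕ→ℚ c * x ≡ ℕ→ℚ c * y [p^ e ] → x ≡ y [p^ e ]
    cancelˡₚ {x = x} {y} c p∤c (mk≡ₚ cx-cy∣) =
      mk≡ₚ (∣-cancelˡ c p∤c (subst (p^[ _ ]∣_) (sym (distrib (ℕ→ℚ c) x y)) cx-cy∣))
      where
      distrib : ∀ c x y → c * (x - y) ≡ c * x - c * y
      distrib = solve-∀ ℚ-ring

    ≡ₚ⇒CongModPow : ∀ {e x y} → x ≡ y [p^ e ] → CongModPow p e x y
    ≡ₚ⇒CongModPow (mk≡ₚ (mk∣ u v p∤v x-y*v≡)) = u , v , p∤v , x-y*v≡

  -- Fermat's little theorem and power sums modulo p²

  module PowerSums {p : ℕ} (p-prime : Prime p) where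

    open PAdic p-prime

    p≡suc[p∸1] : p ≡ suc (p ℕ.∸ 1)
    p≡suc[p∸1] = sym (ℕ.suc-pred p {{prime⇒nonZero p-prime}})

    p∤-<p : ∀ {n} → 0 ℕ.< n → n ℕ.< p → ¬ p ∣ n
    p∤-<p {suc n} _ n<p p∣n = ℕ.<⇒≱ n<p (∣⇒≤ p∣n)

    p^1∣p : p ℕ.^ 1 ∣ p
    p^1∣p = divides 1 (sym (trans (ℕ.*-identityˡ (p ℕ.* 1)) (ℕ.*-identityʳ p)))

    ∣-p : p^[ 1 ]∣ ℕ→ℚ p
    ∣-p = ∣-ℕ-multiple p^1∣p

    p*-congₚ : ∀ {e x y} → x ≡ y [p^ e ] → ℕ→ℚ p * x ≡ ℕ→ℚ p * y [p^ suc e ]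
    p*-congₚ {x = x} {y} (mk≡ₚ x-y∣) = mk≡ₚ (subst (p^[ _ ]∣_) (distrib (ℕ→ℚ p) x y) (∣-* ∣-p x-y∣))
      where
      distrib : ∀ c x y → c * (x - y) ≡ c * x - c * y
      distrib = solve-∀ ℚ-ring

    p∤! : ∀ {n} → n ℕ.< p → ¬ p ∣ n !
    p∤! {zero}  _   = p∤1
    p∤! {suc n} n<p = p∤* (p∤-<p (s≤s z≤n) n<p) (p∤! (ℕ.<-trans (ℕ.n<1+n n) n<p))

    p∣pCk : ∀ {k} → 0 ℕ.< k → k ℕ.< p → p ∣ p C k
    p∣pCk {k} 0<k k<p with euclidsLemma (p C k) (k ! ℕ.* (p ℕ.∸ k) !) p-prime p∣C*k![p∸k]!
      where
      instance _ = k ℕ.!* (p ℕ.∸ k) !≢0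
      p∣C*k![p∸k]! : p ∣ (p C k) ℕ.* (k ! ℕ.* (p ℕ.∸ k) !)
      p∣C*k![p∸k]! = subst (p ∣_) (sym (trans (cong (ℕ._* (k ! ℕ.* (p ℕ.∸ k) !)) (nCk≡n!/k![n-k]! (ℕ.<⇒≤ k<p)))
                                              (m/n*n≡m (k![n∸k]!∣n! (ℕ.<⇒≤ k<p)))))
                           (subst (λ q → q ∣ q !) (sym p≡suc[p∸1]) (divides ((p ℕ.∸ 1) !) (ℕ.*-comm _ ((p ℕ.∸ 1) !))))
    ... | inj₁ p∣C = p∣C
    ... | inj₂ p∣k!* with euclidsLemma (k !) ((p ℕ.∸ k) !) p-prime p∣k!*
    ...   | inj₁ p∣k! = contradiction p∣k! (p∤! k<p)
    ...   | inj₂ p∣[p∸k]! = contradiction p∣[p∸k]! (p∤! (ℕ.∸-monoʳ-< {p} {k} {0} 0<k (ℕ.<⇒≤ k<p)))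

    ∣-ℕ^ : ∀ a n → p^[ 0 ]∣ ℕ→ℚ a ^ n
    ∣-ℕ^ a n = subst (p^[ 0 ]∣_) (ℕ→ℚ-^ a n) (∣-ℕ (a ℕ.^ n))

    ∣-p^≤ : ∀ {e} n → e ℕ.≤ n → p^[ e ]∣ ℕ→ℚ p ^ n
    ∣-p^≤ {e} n e≤n = subst (p^[ e ]∣_) (ℕ→ℚ-^ p n) (∣-ℕ-multiple (divides (p ℕ.^ (n ℕ.∸ e)) p^n≡))
      where
      p^n≡ : p ℕ.^ n ≡ p ℕ.^ (n ℕ.∸ e) ℕ.* p ℕ.^ e
      p^n≡ = trans (cong (p ℕ.^_) (sym (ℕ.m∸n+n≡m e≤n))) (ℕ.^-distribˡ-+-* p (n ℕ.∸ e) e)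

    fermat : ∀ a → ℕ→ℚ a ^ suc (p ℕ.∸ 1) ≡ ℕ→ℚ a [p^ 1 ]
    fermat zero    = ≡ₚ-reflexive (trans (^-homo-* 0ℚ 1 (p ℕ.∸ 1)) (ℚ.*-zeroˡ (0ℚ ^ (p ℕ.∸ 1))))
    fermat (suc a) = begin
      ℕ→ℚ (suc a) ^ suc q                        ≡⟨ cong (_^ suc q) (ℕ→ℚ-suc a) ⟩
      (x + 1ℚ) ^ suc q                            ≡⟨ binomial-ends q x ⟩
      1ℚ + ∑< q middle + x ^ suc q                ≈⟨ +-congₚ (+-congˡₚ 1ℚ middle≡0) (fermat a) ⟩
      1ℚ + 0ℚ + x                                 ≡⟨ cong (_+ x) (ℚ.+-identityʳ 1ℚ) ⟩
      1ℚ + x                                      ≡⟨ ℚ.+-comm 1ℚ x ⟩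
      x + 1ℚ                                      ≡⟨ ℕ→ℚ-suc a ⟨
      ℕ→ℚ (suc a)                                 ∎
      where
      open ≡ₚ-Reasoning 1
      q = p ℕ.∸ 1
      x = ℕ→ℚ a
      middle : ℕ → ℚ
      middle j = ℕ→ℚ (suc q C suc j) * x ^ suc j
      p^1∣C : ∀ j → j ℕ.< q → p ℕ.^ 1 ∣ suc q C suc j
      p^1∣C j j<q = ∣-trans p^1∣p (subst (λ n → p ∣ n C suc j) p≡suc[p∸1]
                      (p∣pCk (s≤s z≤n) (subst (suc j ℕ.<_) (sym p≡suc[p∸1]) (s≤s j<q))))
      middle≡0 : ∑< q middle ≡ 0ℚ [p^ 1 ]
      middle≡0 = ∣⇒≡0 (∣-∑ q (λ j j<q → ∣-* (∣-ℕ-multiple (p^1∣C j j<q)) (∣-ℕ^ a (suc j))))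

    fermat-unit : ∀ {a} → ¬ p ∣ a → ℕ→ℚ a ^ (p ℕ.∸ 1) ≡ 1ℚ [p^ 1 ]
    fermat-unit {zero}  p∤0 = contradiction (divides 0 refl) p∤0
    fermat-unit {suc a} p∤a = begin
      x ^ q                       ≡⟨ ℚ.*-identityˡ (x ^ q) ⟨
      1ℚ * x ^ q                  ≡⟨ cong (_* x ^ q) (inv-* a) ⟨
      inv (suc a) * x * x ^ q     ≡⟨ ℚ.*-assoc (inv (suc a)) x (x ^ q) ⟩
      inv (suc a) * (x * x ^ q)   ≡⟨ cong (inv (suc a) *_) (^-homo-* x 1 q) ⟨
      inv (suc a) * x ^ suc q     ≈⟨ *-congˡₚ (∣-inv p∤a) (fermat (suc a)) ⟩
      inv (suc a) * x             ≡⟨ inv-* a ⟩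
      1ℚ                          ∎
      where
      open ≡ₚ-Reasoning 1
      q = p ℕ.∸ 1
      x = ℕ→ℚ (suc a)

    recurrence-∣ : ∀ {e} (f : ℕ → ℚ) → p^[ e ]∣ f 0 →
                   (∀ n → p^[ e ]∣ ∑[ j < suc (suc n) ] (ℕ→ℚ (suc (suc n) C j) * f j)) →
                   ∀ j → suc j ℕ.< p → p^[ e ]∣ f j
    recurrence-∣ {e} f f0∣ sum∣ j 1+j<p = up-to j 1+j<p j ℕ.≤-refl
      where
      next : ∀ k → suc (suc k) ℕ.< p → (∀ i → i ℕ.≤ k → p^[ e ]∣ f i) → p^[ e ]∣ f (suc k)
      next k 2+k<p below∣ = ∣-cancelˡ (suc (suc k)) (p∤-<p (s≤s z≤n) 2+k<p)
        (subst (p^[ e ]∣_) (binomial-sum-last k f)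
          (∣-+ (sum∣ k) (∣-neg (∣-∑ (suc k) (λ i i<1+k → ∣-* (∣-ℕ (suc (suc k) C i)) (below∣ i (ℕ.≤-pred i<1+k)))))))

      up-to : ∀ k → suc k ℕ.< p → ∀ i → i ℕ.≤ k → p^[ e ]∣ f i
      up-to k       _     zero    _         = f0∣
      up-to zero    _     (suc i) ()
      up-to (suc k) 2+k<p (suc i) (s≤s i≤k) =
        next i (ℕ.≤-trans (s≤s (s≤s (s≤s i≤k))) 2+k<p)
               (λ j j≤i → up-to k (ℕ.<-trans (ℕ.n<1+n (suc k)) 2+k<p) j (ℕ.≤-trans j≤i i≤k))

    B-∣ : ∀ j → suc j ℕ.< p → p^[ 0 ]∣ B j
    B-∣ = recurrence-∣ B (∣-ℕ 1) (λ n → subst (p^[ 0 ]∣_) (sym (B-recurrence n)) ∣-zero)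

    powerSum≡pB : ∀ j → suc j ℕ.< p → powerSum p j ≡ ℕ→ℚ p * B j [p^ 2 ]
    powerSum≡pB j 1+j<p = mk≡ₚ (recurrence-∣ error error₀∣ sum∣ j 1+j<p)
      where
      error : ℕ → ℚ
      error j = powerSum p j - ℕ→ℚ p * B j
      error₀∣ : p^[ 2 ]∣ error 0
      error₀∣ = subst (p^[ 2 ]∣_) (sym (trans (cong (_- ℕ→ℚ p * 1ℚ) (∑-const p 1ℚ)) (ℚ.+-inverseʳ (ℕ→ℚ p * 1ℚ)))) ∣-zero
      sum∣ : ∀ n → p^[ 2 ]∣ ∑[ j < suc (suc n) ] (ℕ→ℚ (suc (suc n) C j) * error j)
      sum∣ n = subst (p^[ 2 ]∣_) (sym sum≡) (∣-p^≤ (suc (suc n)) (s≤s (s≤s z≤n)))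
        where
        N = suc (suc n)
        distrib : ∀ c s P b → c * (s - P * b) ≡ c * s - P * (c * b)
        distrib = solve-∀ ℚ-ring
        sum≡ : ∑[ j < N ] (ℕ→ℚ (N C j) * error j) ≡ ℕ→ℚ p ^ N
        sum≡ = begin
          ∑[ j < N ] (ℕ→ℚ (N C j) * error j)
            ≡⟨ ∑-cong N (λ j _ → distrib (ℕ→ℚ (N C j)) (powerSum p j) (ℕ→ℚ p) (B j)) ⟩
          ∑[ j < N ] (ℕ→ℚ (N C j) * powerSum p j - ℕ→ℚ p * (ℕ→ℚ (N C j) * B j))
            ≡⟨ ∑-distrib-minus N _ _ ⟩
          ∑[ j < N ] (ℕ→ℚ (N C j) * powerSum p j) - ∑[ j < N ] (ℕ→ℚ p * (ℕ→ℚ (N C j) * B j))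
            ≡⟨ cong₂ _-_ (sym (∑-binomial-powerSum p (suc n))) (*-distribˡ-∑ N (ℕ→ℚ p) _) ⟨
          ℕ→ℚ p ^ N - ℕ→ℚ p * (∑[ j < N ] (ℕ→ℚ (N C j) * B j))
            ≡⟨ cong (λ s → ℕ→ℚ p ^ N - ℕ→ℚ p * s) (B-recurrence n) ⟩
          ℕ→ℚ p ^ N - ℕ→ℚ p * 0ℚ
            ≡⟨ cong (λ s → ℕ→ℚ p ^ N - s) (ℚ.*-zeroʳ (ℕ→ℚ p)) ⟩
          ℕ→ℚ p ^ N - 0ℚ
            ≡⟨ ℚ.+-identityʳ (ℕ→ℚ p ^ N) ⟩
          ℕ→ℚ p ^ N ∎
          where open ≡-Reasoning

    powerSum≡0 : ∀ j → suc j ℕ.< p → powerSum p j ≡ 0ℚ [p^ 1 ]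
    powerSum≡0 j 1+j<p = ≡ₚ-trans (≡ₚ-weaken (ℕ.n≤1+n 1) (powerSum≡pB j 1+j<p)) (∣⇒≡0 (∣-* ∣-p (B-∣ j 1+j<p)))

  -- Expansions of inverse powers modulo powers of p

  module Expansions {p : ℕ} (p-prime : Prime p) where

    open PAdic p-prime

    inverse²-expansion : ∀ {e a b δ} → p^[ 0 ]∣ a → p^[ 0 ]∣ b → p^[ e ]∣ δ → a ≡ b * (1ℚ + δ * a) →
      b ^ 2 ≡ a ^ 2 - 2 * δ * a ^ 3 + 3 * δ ^ 2 * a ^ 4 [p^ e ℕ.+ e ℕ.+ e ]
    inverse²-expansion {e} {a} {b} {δ} a∣ b∣ δ∣ a≡ =
      mk≡ₚ (subst (p^[ e ℕ.+ e ℕ.+ e ]∣_) (sym (inverse²-error {a} {b} {δ} a≡))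
        (∣-* (∣-neg (∣-* (∣-* (∣-^ a∣ 3) (∣-+ (∣-ℕ 4) (∣-* (∣-* (∣-ℕ 3) (∣-weaken z≤n δ∣)) a∣))) (∣-^ b∣ 2)))
             (∣-* (∣-* δ∣ δ∣) δ∣)))

    inverse³-expansion : ∀ {e a b δ} → p^[ 0 ]∣ a → p^[ 0 ]∣ b → p^[ e ]∣ δ → a ≡ b * (1ℚ + δ * a) →
      b ^ 3 ≡ a ^ 3 [p^ e ]
    inverse³-expansion {e} {a} {b} {δ} a∣ b∣ δ∣ a≡ =
      mk≡ₚ (subst (p^[ e ]∣_) (sym (inverse³-error {a} {b} {δ} a≡))
        (∣-* (∣-neg (∣-* (∣-* a∣ (∣-^ b∣ 3)) (∣-+ (∣-+ (∣-ℕ 3) (∣-* (∣-* (∣-ℕ 3) δ₀∣) a∣)) (∣-^ (∣-* δ₀∣ a∣) 2)))) δ∣))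
      where δ₀∣ = ∣-weaken z≤n δ∣

    inverse²-expansion₁ : ∀ {e a b δ} → p^[ 0 ]∣ a → p^[ 0 ]∣ b → p^[ e ]∣ δ → a ≡ b * (1ℚ + δ * a) →
      b ^ 2 ≡ a ^ 2 - 2 * δ * a ^ 3 [p^ e ℕ.+ e ]
    inverse²-expansion₁ {e} {a} {b} {δ} a∣ b∣ δ∣ a≡ = begin
      b ^ 2
        ≈⟨ ≡ₚ-weaken (ℕ.m≤m+n (e ℕ.+ e) e) (inverse²-expansion a∣ b∣ δ∣ a≡) ⟩
      a ^ 2 - 2 * δ * a ^ 3 + 3 * δ ^ 2 * a ^ 4
        ≈⟨ +-congˡₚ (a ^ 2 - 2 * δ * a ^ 3) (∣⇒≡0 second-order∣) ⟩
      a ^ 2 - 2 * δ * a ^ 3 + 0ℚ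
        ≡⟨ ℚ.+-identityʳ _ ⟩
      a ^ 2 - 2 * δ * a ^ 3 ∎
      where
      open ≡ₚ-Reasoning (e ℕ.+ e)
      second-order∣ : p^[ e ℕ.+ e ]∣ 3 * δ ^ 2 * a ^ 4
      second-order∣ = ∣-*ʳ (∣-* (∣-ℕ 3) (∣-* δ∣ δ∣)) (∣-^ a∣ 4)

    -- inv^ j r is r ^ -j when p ∤ r and 0 otherwise: the sums of the theorem run over p ∤ k only.
    inv^ : ℕ → ℕ → ℚ
    inv^ j r = if does (p ∣? r) then 0ℚ else inv r ^ j

    inv^-∣ : ∀ j {r} → p ∣ r → inv^ j r ≡ 0ℚ
    inv^-∣ j {r} p∣r = cong (λ b → if b then 0ℚ else inv r ^ j) (dec-true (p ∣? r) p∣r)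

    inv^-∤ : ∀ j {r} → ¬ p ∣ r → inv^ j r ≡ inv r ^ j
    inv^-∤ j {r} p∤r = cong (λ b → if b then 0ℚ else inv r ^ j) (dec-false (p ∣? r) p∤r)

    ∣-inv^ : ∀ j r → p^[ 0 ]∣ inv^ j r
    ∣-inv^ j r with p ∣? r
    ... | yes _   = ∣-zero
    ... | no p∤r  = ∣-^ (∣-inv p∤r) j

    inv-*-unit : ∀ {r} → ¬ p ∣ r → inv r * ℕ→ℚ r ≡ 1ℚ
    inv-*-unit {zero}  p∤0 = contradiction (divides 0 refl) p∤0
    inv-*-unit {suc r} _   = inv-* r

    inv-shift : ∀ {N r} → ¬ p ∣ r → ¬ p ∣ N ℕ.+ r → inv r ≡ inv (N ℕ.+ r) * (1ℚ + ℕ→ℚ N * inv r)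
    inv-shift {N} {r} p∤r p∤N+r =
      inverse-shift {b = inv (N ℕ.+ r)} {δ = ℕ→ℚ N} (inv-*-unit p∤r)
        (trans (cong (inv (N ℕ.+ r) *_) (sym (ℕ→ℚ-+ N r))) (inv-*-unit p∤N+r))

    inv-reflect : ∀ {N r} → r ℕ.≤ N → ¬ p ∣ r → ¬ p ∣ N ℕ.∸ r →
      inv r ≡ - inv (N ℕ.∸ r) * (1ℚ + - ℕ→ℚ N * inv r)
    inv-reflect {N} {r} r≤N p∤r p∤N∸r = inverse-shift {b = - inv (N ℕ.∸ r)} {δ = - ℕ→ℚ N} (inv-*-unit p∤r) (begin
      - inv (N ℕ.∸ r) * (- ℕ→ℚ N + ℕ→ℚ r)      ≡⟨ negate (inv (N ℕ.∸ r)) (ℕ→ℚ N) (ℕ→ℚ r) ⟩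
      inv (N ℕ.∸ r) * (ℕ→ℚ N - ℕ→ℚ r)          ≡⟨ cong (inv (N ℕ.∸ r) *_) (ℕ→ℚ-∸ r≤N) ⟨
      inv (N ℕ.∸ r) * ℕ→ℚ (N ℕ.∸ r)            ≡⟨ inv-*-unit p∤N∸r ⟩
      1ℚ                                       ∎)
      where
      open ≡-Reasoning
      negate : ∀ b n r → - b * (- n + r) ≡ b * (n - r)
      negate = solve-∀ ℚ-ring

    module _ {e N} (p∣N : p ∣ N) (N∣ : p^[ e ]∣ ℕ→ℚ N) where

      inv²-shift : ∀ r → inv^ 2 (N ℕ.+ r) ≡ inv^ 2 r - 2 * ℕ→ℚ N * inv^ 3 r + 3 * ℕ→ℚ N ^ 2 * inv^ 4 r [p^ e ℕ.+ e ℕ.+ e ]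
      inv²-shift r with p ∣? r | p ∣? (N ℕ.+ r)
      ... | yes _   | yes _    =
        ≡ₚ-reflexive (sym (cong₂ (λ a b → 0ℚ - a + b) (ℚ.*-zeroʳ (2 * ℕ→ℚ N)) (ℚ.*-zeroʳ (3 * ℕ→ℚ N ^ 2))))
      ... | yes p∣r | no p∤N+r = contradiction (∣m∣n⇒∣m+n p∣N p∣r) p∤N+r
      ... | no p∤r  | yes p∣N+r = contradiction (∣m+n∣m⇒∣n p∣N+r p∣N) p∤r
      ... | no p∤r  | no p∤N+r = inverse²-expansion (∣-inv p∤r) (∣-inv p∤N+r) N∣ (inv-shift p∤r p∤N+r)

      inv²-shift₁ : ∀ r → inv^ 2 (N ℕ.+ r) ≡ inv^ 2 r - 2 * ℕ→ℚ N * inv^ 3 r [p^ e ℕ.+ e ]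
      inv²-shift₁ r with p ∣? r | p ∣? (N ℕ.+ r)
      ... | yes _   | yes _    = ≡ₚ-reflexive (sym (cong (λ a → 0ℚ - a) (ℚ.*-zeroʳ (2 * ℕ→ℚ N))))
      ... | yes p∣r | no p∤N+r = contradiction (∣m∣n⇒∣m+n p∣N p∣r) p∤N+r
      ... | no p∤r  | yes p∣N+r = contradiction (∣m+n∣m⇒∣n p∣N+r p∣N) p∤r
      ... | no p∤r  | no p∤N+r = inverse²-expansion₁ (∣-inv p∤r) (∣-inv p∤N+r) N∣ (inv-shift p∤r p∤N+r)

      p∣N∸r⇒p∣r : ∀ {r} → r ℕ.≤ N → p ∣ N ℕ.∸ r → p ∣ r
      p∣N∸r⇒p∣r {r} r≤N p∣N∸r = ∣m+n∣m⇒∣n (subst (p ∣_) (sym (ℕ.m∸n+n≡m r≤N)) p∣N) p∣N∸r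

      p∣r⇒p∣N∸r : ∀ {r} → r ℕ.≤ N → p ∣ r → p ∣ N ℕ.∸ r
      p∣r⇒p∣N∸r {r} r≤N p∣r = ∣m+n∣m⇒∣n (subst (p ∣_) (sym (ℕ.m+[n∸m]≡n r≤N)) p∣N) p∣r

      inv²-reflect : ∀ {r} → r ℕ.≤ N → inv^ 2 (N ℕ.∸ r) ≡ inv^ 2 r + 2 * ℕ→ℚ N * inv^ 3 r [p^ e ℕ.+ e ]
      inv²-reflect {r} r≤N with p ∣? r | p ∣? (N ℕ.∸ r)
      ... | yes _   | yes _     = ≡ₚ-reflexive (sym (cong (0ℚ +_) (ℚ.*-zeroʳ (2 * ℕ→ℚ N))))
      ... | yes p∣r | no p∤N∸r  = contradiction (p∣r⇒p∣N∸r r≤N p∣r) p∤N∸r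
      ... | no p∤r  | yes p∣N∸r = contradiction (p∣N∸r⇒p∣r r≤N p∣N∸r) p∤r
      ... | no p∤r  | no p∤N∸r  = begin
        inv (N ℕ.∸ r) ^ 2
          ≡⟨ square-neg (inv (N ℕ.∸ r)) ⟩
        (- inv (N ℕ.∸ r)) ^ 2
          ≈⟨ inverse²-expansion₁ (∣-inv p∤r) (∣-neg (∣-inv p∤N∸r)) (∣-neg N∣) (inv-reflect r≤N p∤r p∤N∸r) ⟩
        inv r ^ 2 - 2 * - ℕ→ℚ N * inv r ^ 3
          ≡⟨ sign (inv r) (ℕ→ℚ N) ⟩
        inv r ^ 2 + 2 * ℕ→ℚ N * inv r ^ 3 ∎
        where
        open ≡ₚ-Reasoning (e ℕ.+ e)
        square-neg : ∀ b → b ^ 2 ≡ (- b) ^ 2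
        square-neg = solve-∀ ℚ-ring
        sign : ∀ a n → a ^ 2 - 2 * - n * a ^ 3 ≡ a ^ 2 + 2 * n * a ^ 3
        sign = solve-∀ ℚ-ring

      inv³-reflect : ∀ {r} → r ℕ.≤ N → inv^ 3 r + inv^ 3 (N ℕ.∸ r) ≡ 0ℚ [p^ e ]
      inv³-reflect {r} r≤N with p ∣? r | p ∣? (N ℕ.∸ r)
      ... | yes _   | yes _     = ≡ₚ-reflexive (ℚ.+-identityʳ 0ℚ)
      ... | yes p∣r | no p∤N∸r  = contradiction (p∣r⇒p∣N∸r r≤N p∣r) p∤N∸r
      ... | no p∤r  | yes p∣N∸r = contradiction (p∣N∸r⇒p∣r r≤N p∣N∸r) p∤r
      ... | no p∤r  | no p∤N∸r  = begin
        inv r ^ 3 + inv (N ℕ.∸ r) ^ 3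
          ≈⟨ +-congʳₚ (inv (N ℕ.∸ r) ^ 3)
               (≡ₚ-sym (inverse³-expansion (∣-inv p∤r) (∣-neg (∣-inv p∤N∸r)) (∣-neg N∣) (inv-reflect r≤N p∤r p∤N∸r))) ⟩
        (- inv (N ℕ.∸ r)) ^ 3 + inv (N ℕ.∸ r) ^ 3
          ≡⟨ cancel (inv (N ℕ.∸ r)) ⟩
        0ℚ ∎
        where
        open ≡ₚ-Reasoning e
        cancel : ∀ b → (- b) ^ 3 + b ^ 3 ≡ 0ℚ
        cancel = solve-∀ ℚ-ring

    module _ (p∤2 : ¬ p ∣ 2) where

      p∣r+r⇒p∣r : ∀ {r} → p ∣ r ℕ.+ r → p ∣ r
      p∣r+r⇒p∣r {r} p∣r+r with euclidsLemma 2 r p-prime (subst (p ∣_) (cong (r ℕ.+_) (sym (ℕ.+-identityʳ r))) p∣r+r)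
      ... | inj₁ p∣2 = contradiction p∣2 p∤2
      ... | inj₂ p∣r = p∣r

      inv^-double : ∀ j r → 2 ^ j * inv^ j (r ℕ.+ r) ≡ inv^ j r
      inv^-double j r with p ∣? r | p ∣? (r ℕ.+ r)
      ... | yes _   | yes _      = ℚ.*-zeroʳ (2 ^ j)
      ... | yes p∣r | no p∤r+r   = contradiction (∣m∣n⇒∣m+n p∣r p∣r) p∤r+r
      ... | no p∤r  | yes p∣r+r  = contradiction (p∣r+r⇒p∣r p∣r+r) p∤r
      ... | no p∤r  | no p∤r+r   = begin
        2 ^ j * inv (r ℕ.+ r) ^ j               ≡⟨ ^-distrib-* 2 (inv (r ℕ.+ r)) j ⟨
        (2 * inv (r ℕ.+ r)) ^ j                 ≡⟨ cong (_^ j) halve ⟩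
        inv r ^ j                               ∎
        where
        open ≡-Reasoning
        c = inv (r ℕ.+ r)
        a = inv r
        x = ℕ→ℚ r
        regroup : ∀ c a x → 2 * c * (a * x) ≡ c * (x + x) * a
        regroup = solve-∀ ℚ-ring
        halve : 2 * c ≡ a
        halve = begin
          2 * c                    ≡⟨ ℚ.*-identityʳ (2 * c) ⟨
          2 * c * 1ℚ               ≡⟨ cong (2 * c *_) (inv-*-unit p∤r) ⟨
          2 * c * (a * x)          ≡⟨ regroup c a x ⟩
          c * (x + x) * a          ≡⟨ cong (λ y → c * y * a) (ℕ→ℚ-+ r r) ⟨
          c * ℕ→ℚ (r ℕ.+ r) * a    ≡⟨ cong (_* a) (inv-*-unit p∤r+r) ⟩
          1ℚ * a                   ≡⟨ ℚ.*-identityˡ a ⟩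
          a                        ∎

    binomial₁ : ∀ {e x δ} → p^[ 0 ]∣ x → p^[ e ]∣ δ → ∀ n →
                (x + δ) ^ suc n ≡ x ^ suc n + ℕ→ℚ (suc n) * δ * x ^ n [p^ e ℕ.+ e ]
    binomial₁ {e} {x} {δ} x∣ δ∣ zero    = ≡ₚ-reflexive (linear x δ)
      where
      linear : ∀ x δ → x + δ ≡ x + 1ℚ * δ * 1ℚ
      linear = solve-∀ ℚ-ring
    binomial₁ {e} {x} {δ} x∣ δ∣ (suc n) = begin
      (x + δ) ^ suc (suc n)
        ≡⟨ ^-homo-* (x + δ) 1 (suc n) ⟩
      (x + δ) * (x + δ) ^ suc n
        ≈⟨ *-congˡₚ (∣-+ x∣ (∣-weaken z≤n δ∣)) (binomial₁ x∣ δ∣ n) ⟩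
      (x + δ) * (x ^ suc n + c * δ * x ^ n)
        ≡⟨ cong (λ z → (x + δ) * (z + c * δ * x ^ n)) (^-homo-* x 1 n) ⟩
      (x + δ) * (x * x ^ n + c * δ * x ^ n)
        ≡⟨ expand x δ c (x ^ n) ⟩
      x * (x * x ^ n) + (c + 1ℚ) * δ * (x * x ^ n) + c * x ^ n * (δ * δ)
        ≈⟨ +-congˡₚ (x * (x * x ^ n) + (c + 1ℚ) * δ * (x * x ^ n)) (∣⇒≡0 (∣-* (∣-* (∣-ℕ (suc n)) (∣-^ x∣ n)) (∣-* δ∣ δ∣))) ⟩
      x * (x * x ^ n) + (c + 1ℚ) * δ * (x * x ^ n) + 0ℚ
        ≡⟨ ℚ.+-identityʳ _ ⟩
      x * (x * x ^ n) + (c + 1ℚ) * δ * (x * x ^ n)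
        ≡⟨ cong₂ (λ y z → x * y + z * δ * y) (^-homo-* x 1 n) (ℕ→ℚ-suc (suc n)) ⟨
      x * x ^ suc n + ℕ→ℚ (suc (suc n)) * δ * x ^ suc n
        ≡⟨ cong (_+ ℕ→ℚ (suc (suc n)) * δ * x ^ suc n) (^-homo-* x 1 (suc n)) ⟨
      x ^ suc (suc n) + ℕ→ℚ (suc (suc n)) * δ * x ^ suc n ∎
      where
      open ≡ₚ-Reasoning (e ℕ.+ e)
      c = ℕ→ℚ (suc n)
      expand : ∀ x δ c y → (x + δ) * (x * y + c * δ * y) ≡ x * (x * y) + (c + 1ℚ) * δ * (x * y) + c * y * (δ * δ)
      expand = solve-∀ ℚ-ring

  -- Folding sums over [0, P] in half, for odd P

  module HalfSums {p : ℕ} (p-prime : Prime p) where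

    open PAdic p-prime
    open Expansions p-prime

    module _ {e P} (n : ℕ) (f g : ℕ → ℚ) (n+n≡1+P : n ℕ.+ n ≡ suc P)
             (reflect : ∀ {r} → r ℕ.≤ P → f (P ℕ.∸ r) ≡ f r + g r [p^ e ]) where

      private
        r+r≤P : ∀ {r} → r ℕ.< n → r ℕ.+ r ℕ.≤ P
        r+r≤P r<n = ℕ.<⇒≤ (r<h⇒r+r<P n+n≡1+P r<n)

        r≤P : ∀ {r} → r ℕ.< n → r ℕ.≤ P
        r≤P {r} r<n = ℕ.≤-trans (ℕ.m≤m+n r r) (r+r≤P r<n)

        double : ∀ x y → x + (x + y) ≡ 2 * x + y
        double = solve-∀ ℚ-ring

      fold-relation : ∑< (suc P) f ≡ 2 * ∑< n f + ∑< n g [p^ e ]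
      fold-relation = begin
        ∑< (suc P) f                          ≡⟨ ∑-fold n f n+n≡1+P ⟩
        ∑[ r < n ] (f r + f (P ℕ.∸ r))        ≈⟨ ∑-congₚ n (λ r r<n → +-congˡₚ (f r) (reflect (r≤P r<n))) ⟩
        ∑[ r < n ] (f r + (f r + g r))        ≡⟨ ∑-cong n (λ r _ → double (f r) (g r)) ⟩
        ∑[ r < n ] (2 * f r + g r)            ≡⟨ ∑-distrib-+ n (λ r → 2 * f r) g ⟩
        ∑[ r < n ] (2 * f r) + ∑< n g         ≡⟨ cong (_+ ∑< n g) (*-distribˡ-∑ n 2 f) ⟨
        2 * ∑< n f + ∑< n g                   ∎
        where open ≡ₚ-Reasoning e

      fold-evens-relation : ∑< (suc P) f ≡ ∑[ r < n ] (2 * f (r ℕ.+ r) + g (r ℕ.+ r)) [p^ e ]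
      fold-evens-relation = begin
        ∑< (suc P) f
          ≡⟨ ∑-fold-evens n f n+n≡1+P ⟩
        ∑[ r < n ] (f (r ℕ.+ r) + f (P ℕ.∸ (r ℕ.+ r)))
          ≈⟨ ∑-congₚ n (λ r r<n → +-congˡₚ (f (r ℕ.+ r)) (reflect (r+r≤P r<n))) ⟩
        ∑[ r < n ] (f (r ℕ.+ r) + (f (r ℕ.+ r) + g (r ℕ.+ r)))
          ≡⟨ ∑-cong n (λ r _ → double (f (r ℕ.+ r)) (g (r ℕ.+ r))) ⟩
        ∑[ r < n ] (2 * f (r ℕ.+ r) + g (r ℕ.+ r)) ∎
        where open ≡ₚ-Reasoning e

    half-relations : ∀ {e S H Q} → S ≡ 2 * H + 2 * Q [p^ e ] → 4 * S ≡ 2 * H + Q [p^ e ] →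
                     Q ≡ - (3 * S) [p^ e ] × 2 * H ≡ 7 * S [p^ e ]
    half-relations {e} {S} {H} {Q} S≡ 4S≡ = Q≡ , 2H≡
      where
      open ≡ₚ-Reasoning e
      Q≡ : Q ≡ - (3 * S) [p^ e ]
      Q≡ = begin
        Q                                     ≡⟨ solve (S ∷ H ∷ Q ∷ []) ℚ-ring ⟩
        (2 * H + 2 * Q) - (2 * H + Q)         ≈⟨ +-congₚ (≡ₚ-sym S≡) (neg-congₚ (≡ₚ-sym 4S≡)) ⟩
        S - 4 * S                             ≡⟨ solve (S ∷ H ∷ Q ∷ []) ℚ-ring ⟩
        - (3 * S)                             ∎
      2H≡ : 2 * H ≡ 7 * S [p^ e ]
      2H≡ = begin
        2 * H                                 ≡⟨ solve (S ∷ H ∷ Q ∷ []) ℚ-ring ⟩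
        (2 * H + 2 * Q) - 2 * Q               ≈⟨ +-congₚ (≡ₚ-sym S≡) (neg-congₚ (*-congˡₚ (∣-ℕ 2) Q≡)) ⟩
        S - 2 * - (3 * S)                     ≡⟨ solve (S ∷ H ∷ Q ∷ []) ℚ-ring ⟩
        7 * S                                 ∎

    module _ {e N} (p∣N : p ∣ N) (N∣ : p^[ e ]∣ ℕ→ℚ N) (k : ℕ) where

      ∑-inv²-shift : ∑[ r < k ] inv^ 2 (N ℕ.+ r)
                     ≡ ∑< k (inv^ 2) - 2 * ℕ→ℚ N * ∑< k (inv^ 3) + 3 * ℕ→ℚ N ^ 2 * ∑< k (inv^ 4) [p^ e ℕ.+ e ℕ.+ e ]
      ∑-inv²-shift = begin
        ∑[ r < k ] inv^ 2 (N ℕ.+ r)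
          ≈⟨ ∑-congₚ k (λ r _ → inv²-shift p∣N N∣ r) ⟩
        ∑[ r < k ] (inv^ 2 r - 2 * ℕ→ℚ N * inv^ 3 r + 3 * ℕ→ℚ N ^ 2 * inv^ 4 r)
          ≡⟨ ∑-distrib-+ k _ _ ⟩
        ∑[ r < k ] (inv^ 2 r - 2 * ℕ→ℚ N * inv^ 3 r) + ∑[ r < k ] (3 * ℕ→ℚ N ^ 2 * inv^ 4 r)
          ≡⟨ cong (_+ ∑[ r < k ] (3 * ℕ→ℚ N ^ 2 * inv^ 4 r)) (∑-distrib-minus k _ _) ⟩
        ∑< k (inv^ 2) - ∑[ r < k ] (2 * ℕ→ℚ N * inv^ 3 r) + ∑[ r < k ] (3 * ℕ→ℚ N ^ 2 * inv^ 4 r)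
          ≡⟨ cong₂ (λ a b → ∑< k (inv^ 2) - a + b)
                   (*-distribˡ-∑ k (2 * ℕ→ℚ N) (inv^ 3)) (*-distribˡ-∑ k (3 * ℕ→ℚ N ^ 2) (inv^ 4)) ⟨
        ∑< k (inv^ 2) - 2 * ℕ→ℚ N * ∑< k (inv^ 3) + 3 * ℕ→ℚ N ^ 2 * ∑< k (inv^ 4) ∎
        where open ≡ₚ-Reasoning (e ℕ.+ e ℕ.+ e)

      ∑-inv²-shift₁ : ∑[ r < k ] inv^ 2 (N ℕ.+ r) ≡ ∑< k (inv^ 2) - 2 * ℕ→ℚ N * ∑< k (inv^ 3) [p^ e ℕ.+ e ]
      ∑-inv²-shift₁ = begin
        ∑[ r < k ] inv^ 2 (N ℕ.+ r)
          ≈⟨ ∑-congₚ k (λ r _ → inv²-shift₁ p∣N N∣ r) ⟩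
        ∑[ r < k ] (inv^ 2 r - 2 * ℕ→ℚ N * inv^ 3 r)
          ≡⟨ ∑-distrib-minus k _ _ ⟩
        ∑< k (inv^ 2) - ∑[ r < k ] (2 * ℕ→ℚ N * inv^ 3 r)
          ≡⟨ cong (λ a → ∑< k (inv^ 2) - a) (*-distribˡ-∑ k (2 * ℕ→ℚ N) (inv^ 3)) ⟨
        ∑< k (inv^ 2) - 2 * ℕ→ℚ N * ∑< k (inv^ 3) ∎
        where open ≡ₚ-Reasoning (e ℕ.+ e)

      ∑-inv²-reflect : k ℕ.≤ N → ∑[ s < k ] inv^ 2 (N ℕ.∸ s) ≡ ∑< k (inv^ 2) + 2 * ℕ→ℚ N * ∑< k (inv^ 3) [p^ e ℕ.+ e ]
      ∑-inv²-reflect k≤N = begin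
        ∑[ s < k ] inv^ 2 (N ℕ.∸ s)
          ≈⟨ ∑-congₚ k (λ s s<k → inv²-reflect p∣N N∣ (ℕ.≤-trans (ℕ.n≤1+n s) (ℕ.≤-trans s<k k≤N))) ⟩
        ∑[ s < k ] (inv^ 2 s + 2 * ℕ→ℚ N * inv^ 3 s)
          ≡⟨ ∑-distrib-+ k _ _ ⟩
        ∑< k (inv^ 2) + ∑[ s < k ] (2 * ℕ→ℚ N * inv^ 3 s)
          ≡⟨ cong (∑< k (inv^ 2) +_) (*-distribˡ-∑ k (2 * ℕ→ℚ N) (inv^ 3)) ⟨
        ∑< k (inv^ 2) + 2 * ℕ→ℚ N * ∑< k (inv^ 3) ∎
        where open ≡ₚ-Reasoning (e ℕ.+ e)

    module InverseSums {m} (1≤m : 1 ℕ.≤ m) (h : ℕ) (h+h≡1+P : h ℕ.+ h ≡ suc (p ℕ.^ m)) where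

      P : ℕ
      P = p ℕ.^ m

      p∣P : p ∣ P
      p∣P = subst (λ k → p ∣ p ℕ.^ k) (ℕ.m+[n∸m]≡n 1≤m) (divides (p ℕ.^ (m ℕ.∸ 1)) (ℕ.*-comm p _))

      P∣ : p^[ m ]∣ ℕ→ℚ P
      P∣ = ∣-p^ m

      S T₃ T₄ H₂ H₃ : ℚ
      S  = ∑< P (inv^ 2)
      T₃ = ∑< P (inv^ 3)
      T₄ = ∑< P (inv^ 4)
      H₂ = ∑< h (inv^ 2)
      H₃ = ∑< h (inv^ 3)

      ∑-to-P : ∀ j → ∑< (suc P) (inv^ j) ≡ ∑< P (inv^ j)
      ∑-to-P j = trans (cong (∑< P (inv^ j) +_) (inv^-∣ j p∣P)) (ℚ.+-identityʳ (∑< P (inv^ j)))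

      S≡2H₂+2PH₃ : S ≡ 2 * H₂ + 2 * (ℕ→ℚ P * H₃) [p^ m ℕ.+ m ]
      S≡2H₂+2PH₃ = begin
        S
          ≡⟨ ∑-to-P 2 ⟨
        ∑< (suc P) (inv^ 2)
          ≈⟨ fold-relation h (inv^ 2) (λ r → 2 * ℕ→ℚ P * inv^ 3 r) h+h≡1+P (inv²-reflect p∣P P∣) ⟩
        2 * H₂ + ∑[ r < h ] (2 * ℕ→ℚ P * inv^ 3 r)
          ≡⟨ cong (2 * H₂ +_) (*-distribˡ-∑ h (2 * ℕ→ℚ P) (inv^ 3)) ⟨
        2 * H₂ + 2 * ℕ→ℚ P * H₃
          ≡⟨ cong (2 * H₂ +_) (ℚ.*-assoc 2 (ℕ→ℚ P) H₃) ⟩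
        2 * H₂ + 2 * (ℕ→ℚ P * H₃) ∎
        where open ≡ₚ-Reasoning (m ℕ.+ m)

      4S≡2H₂+PH₃ : ¬ p ∣ 2 → 4 * S ≡ 2 * H₂ + ℕ→ℚ P * H₃ [p^ m ℕ.+ m ]
      4S≡2H₂+PH₃ p∤2 = begin
        4 * S
          ≡⟨ cong (4 *_) (∑-to-P 2) ⟨
        4 * ∑< (suc P) (inv^ 2)
          ≈⟨ *-congˡₚ (∣-ℕ 4) (fold-evens-relation h (inv^ 2) (λ r → 2 * ℕ→ℚ P * inv^ 3 r) h+h≡1+P (inv²-reflect p∣P P∣)) ⟩
        4 * (∑[ r < h ] (2 * inv^ 2 (r ℕ.+ r) + 2 * ℕ→ℚ P * inv^ 3 (r ℕ.+ r)))
          ≡⟨ *-distribˡ-∑ h 4 _ ⟩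
        ∑[ r < h ] (4 * (2 * inv^ 2 (r ℕ.+ r) + 2 * ℕ→ℚ P * inv^ 3 (r ℕ.+ r)))
          ≡⟨ ∑-cong h (λ r _ → rescale (inv^ 2 (r ℕ.+ r)) (inv^ 3 (r ℕ.+ r)) (ℕ→ℚ P)) ⟩
        ∑[ r < h ] (2 * (2 ^ 2 * inv^ 2 (r ℕ.+ r)) + ℕ→ℚ P * (2 ^ 3 * inv^ 3 (r ℕ.+ r)))
          ≡⟨ ∑-cong h (λ r _ → cong₂ (λ a b → 2 * a + ℕ→ℚ P * b) (inv^-double p∤2 2 r) (inv^-double p∤2 3 r)) ⟩
        ∑[ r < h ] (2 * inv^ 2 r + ℕ→ℚ P * inv^ 3 r)
          ≡⟨ ∑-distrib-+ h _ _ ⟩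
        ∑[ r < h ] (2 * inv^ 2 r) + ∑[ r < h ] (ℕ→ℚ P * inv^ 3 r)
          ≡⟨ cong₂ _+_ (*-distribˡ-∑ h 2 (inv^ 2)) (*-distribˡ-∑ h (ℕ→ℚ P) (inv^ 3)) ⟨
        2 * H₂ + ℕ→ℚ P * H₃ ∎
        where
        open ≡ₚ-Reasoning (m ℕ.+ m)
        rescale : ∀ a b P → 4 * (2 * a + 2 * P * b) ≡ 2 * (2 ^ 2 * a) + P * (2 ^ 3 * b)
        rescale = solve-∀ ℚ-ring

      T₃≡0 : T₃ ≡ 0ℚ [p^ m ]
      T₃≡0 = begin
        T₃                                            ≡⟨ ∑-to-P 3 ⟨
        ∑< (suc P) (inv^ 3)                           ≡⟨ ∑-fold h (inv^ 3) h+h≡1+P ⟩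
        ∑[ r < h ] (inv^ 3 r + inv^ 3 (P ℕ.∸ r))      ≈⟨ ∑-congₚ h (λ r r<h → inv³-reflect p∣P P∣ (r≤P r<h)) ⟩
        ∑[ r < h ] 0ℚ                                 ≡⟨ trans (∑-const h 0ℚ) (ℚ.*-zeroʳ (ℕ→ℚ h)) ⟩
        0ℚ                                            ∎
        where
        open ≡ₚ-Reasoning m
        r≤P : ∀ {r} → r ℕ.< h → r ℕ.≤ P
        r≤P {r} r<h = ℕ.≤-trans (ℕ.m≤m+n r r) (ℕ.<⇒≤ (r<h⇒r+r<P h+h≡1+P r<h))

  parity : ∀ n → ∃[ q ] (n ≡ q ℕ.+ q ⊎ n ≡ suc (q ℕ.+ q))
  parity zero    = 0 , inj₁ refl
  parity (suc n) with parity n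
  ... | q , inj₁ n≡q+q = q , inj₂ (cong suc n≡q+q)
  ... | q , inj₂ n≡1+q+q = suc q , inj₁ (cong suc (trans n≡1+q+q (sym (ℕ.+-suc q q))))

  odd-* : ∀ {x y} → ∃[ a ] x ≡ suc (a ℕ.+ a) → ∃[ b ] y ≡ suc (b ℕ.+ b) → ∃[ c ] x ℕ.* y ≡ suc (c ℕ.+ c)
  odd-* (a , refl) (b , refl) = a ℕ.+ b ℕ.+ a ℕ.* (b ℕ.+ b) , product a b
    where
    product : ∀ a b → suc (a ℕ.+ a) ℕ.* suc (b ℕ.+ b) ≡ suc (a ℕ.+ b ℕ.+ a ℕ.* (b ℕ.+ b) ℕ.+ (a ℕ.+ b ℕ.+ a ℕ.* (b ℕ.+ b)))
    product = ℕ.solve-∀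

  module Main {p : ℕ} (p-prime : Prime p) (5≤p : 5 ℕ.≤ p) where

    open PAdic p-prime
    open PowerSums p-prime
    open Expansions p-prime
    open HalfSums p-prime

    3<p : 3 ℕ.< p
    3<p = ℕ.≤-trans (ℕ.n≤1+n 4) 5≤p

    2<p : 2 ℕ.< p
    2<p = ℕ.<-trans (ℕ.n<1+n 2) 3<p

    p∤2 : ¬ p ∣ 2
    p∤2 = p∤-<p (s≤s z≤n) 2<p

    p∤3 : ¬ p ∣ 3
    p∤3 = p∤-<p (s≤s z≤n) 3<p

    p∤6 : ¬ p ∣ 6
    p∤6 = p∤* p∤2 p∤3

    p-odd : ∃[ q ] p ≡ suc (q ℕ.+ q)
    p-odd with parity p
    ... | q , inj₂ p≡1+q+q = q , p≡1+q+q
    ... | q , inj₁ p≡q+q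
      with prime⇒irreducible p-prime {2} (divides q (trans p≡q+q (trans (cong (q ℕ.+_) (sym (ℕ.+-identityʳ q))) (ℕ.*-comm 2 q))))
    ...   | inj₁ ()
    ...   | inj₂ 2≡p = contradiction 5≤p (subst (λ n → ¬ 5 ℕ.≤ n) 2≡p λ { (s≤s (s≤s ())) })

    half : ∀ m → ∃[ h ] h ℕ.+ h ≡ suc (p ℕ.^ m)
    half m with odd-^ m
      where
      odd-^ : ∀ m → ∃[ a ] p ℕ.^ m ≡ suc (a ℕ.+ a)
      odd-^ zero    = 0 , refl
      odd-^ (suc m) = odd-* p-odd (odd-^ m)
    ... | a , P≡ = suc a , trans (ℕ.+-suc (suc a) a) (cong suc (sym P≡))

    1+m≤m+m : ∀ {m} → 1 ℕ.≤ m → suc m ℕ.≤ m ℕ.+ m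
    1+m≤m+m {m} 1≤m = subst (ℕ._≤ m ℕ.+ m) (ℕ.+-comm m 1) (ℕ.+-monoʳ-≤ m 1≤m)

    2+m≤m+m+1 : ∀ {m} → 1 ℕ.≤ m → suc (suc m) ℕ.≤ m ℕ.+ m ℕ.+ 1
    2+m≤m+m+1 {m} 1≤m = subst (ℕ._≤ m ℕ.+ m ℕ.+ 1) (ℕ.+-comm (suc m) 1) (ℕ.+-monoˡ-≤ 1 (1+m≤m+m 1≤m))

    2+m≤m+m+m : ∀ {m} → 1 ℕ.≤ m → suc (suc m) ℕ.≤ m ℕ.+ m ℕ.+ m
    2+m≤m+m+m {m} 1≤m = ℕ.≤-trans (2+m≤m+m+1 1≤m) (ℕ.+-monoʳ-≤ (m ℕ.+ m) 1≤m)

    S : ℕ → ℚ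
    S m = ∑< (p ℕ.^ m) (inv^ 2)

    -- Expand each of the p blocks of length P to second order; the terms linear and quadratic in the
    -- block index a vanish modulo p ^ (m + 2) after summation, since p divides ∑ a and ∑ a²
    -- and p ^ m divides T₃.
    S-step : ∀ {m} → 1 ℕ.≤ m → S (suc m) ≡ ℕ→ℚ p * S m [p^ suc (suc m) ]
    S-step {m} 1≤m = begin
      S (suc m)
        ≡⟨ ∑-blocks p P (inv^ 2) ⟩
      ∑[ a < p ] ∑[ r < P ] inv^ 2 (a ℕ.* P ℕ.+ r)
        ≈⟨ ≡ₚ-weaken (2+m≤m+m+m 1≤m) (∑-congₚ p (λ a _ → ∑-inv²-shift (p∣aP a) (aP∣ a) P)) ⟩
      ∑[ a < p ] (S m - 2 * ℕ→ℚ (a ℕ.* P) * T₃ + 3 * ℕ→ℚ (a ℕ.* P) ^ 2 * T₄)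
        ≡⟨ ∑-cong p (λ a _ → collect a) ⟩
      ∑[ a < p ] (S m - 2 * ℕ→ℚ P * T₃ * ℕ→ℚ a + 3 * ℕ→ℚ P ^ 2 * T₄ * ℕ→ℚ a ^ 2)
        ≡⟨ ∑-quadratic p (S m) (2 * ℕ→ℚ P * T₃) (3 * ℕ→ℚ P ^ 2 * T₄) ⟩
      ℕ→ℚ p * S m - 2 * ℕ→ℚ P * T₃ * powerSum p 1 + 3 * ℕ→ℚ P ^ 2 * T₄ * powerSum p 2
        ≈⟨ +-congₚ (+-congˡₚ (ℕ→ℚ p * S m) (neg-congₚ (∣⇒≡0 linear∣))) (∣⇒≡0 quadratic∣) ⟩
      ℕ→ℚ p * S m - 0ℚ + 0ℚ
        ≡⟨ drop-zeros (ℕ→ℚ p * S m) ⟩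
      ℕ→ℚ p * S m ∎
      where
      open ≡ₚ-Reasoning (suc (suc m))
      P = p ℕ.^ m
      h = proj₁ (half m)
      open InverseSums 1≤m h (proj₂ (half m)) using (p∣P; P∣; T₃; T₄; T₃≡0)

      p∣aP : ∀ a → p ∣ a ℕ.* P
      p∣aP a = ∣-trans p∣P (n∣m*n a)

      aP∣ : ∀ a → p^[ m ]∣ ℕ→ℚ (a ℕ.* P)
      aP∣ a = ∣-ℕ-multiple (n∣m*n a)

      collect : ∀ a → S m - 2 * ℕ→ℚ (a ℕ.* P) * T₃ + 3 * ℕ→ℚ (a ℕ.* P) ^ 2 * T₄
                    ≡ S m - 2 * ℕ→ℚ P * T₃ * ℕ→ℚ a + 3 * ℕ→ℚ P ^ 2 * T₄ * ℕ→ℚ a ^ 2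
      collect a = trans (cong (λ N → S m - 2 * N * T₃ + 3 * N ^ 2 * T₄) (ℕ→ℚ-* a P)) (regroup (S m) T₃ T₄ (ℕ→ℚ a) (ℕ→ℚ P))
        where
        regroup : ∀ s t₃ t₄ a P → s - 2 * (a * P) * t₃ + 3 * (a * P) ^ 2 * t₄ ≡ s - 2 * P * t₃ * a + 3 * P ^ 2 * t₄ * a ^ 2
        regroup = solve-∀ ℚ-ring

      linear∣ : p^[ suc (suc m) ]∣ 2 * ℕ→ℚ P * T₃ * powerSum p 1
      linear∣ = ∣-weaken (2+m≤m+m+1 1≤m)
                  (∣-* (∣-* (∣-* (∣-ℕ 2) P∣) (≡0⇒∣ T₃≡0)) (≡0⇒∣ (powerSum≡0 1 2<p)))

      quadratic∣ : p^[ suc (suc m) ]∣ 3 * ℕ→ℚ P ^ 2 * T₄ * powerSum p 2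
      quadratic∣ = ∣-weaken (2+m≤m+m+1 1≤m)
                     (∣-* (∣-*ʳ (∣-* (∣-ℕ 3) (∣-* P∣ P∣)) (∣-∑ P (λ r _ → ∣-inv^ 4 r)))
                          (≡0⇒∣ (powerSum≡0 2 3<p)))

      drop-zeros : ∀ x → x - 0ℚ + 0ℚ ≡ x
      drop-zeros = solve-∀ ℚ-ring

    module BaseCase (t : ℕ) (p≡ : p ≡ suc (suc (suc t) ℕ.+ suc (suc t))) where

      h k k′ : ℕ
      h  = suc (suc (suc t))
      k  = suc t ℕ.+ suc t
      k′ = t ℕ.+ suc t

      h+h≡1+p : h ℕ.+ h ≡ suc p
      h+h≡1+p = trans (cong suc (ℕ.+-suc (suc (suc t)) (suc (suc t)))) (cong suc (sym p≡))

      k+3≡p : k ℕ.+ 3 ≡ p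
      k+3≡p = trans (arith t) (sym p≡)
        where
        arith : ∀ t → suc t ℕ.+ suc t ℕ.+ 3 ≡ suc (suc (suc t) ℕ.+ suc (suc t))
        arith = ℕ.solve-∀

      p∸1≡3+k′ : p ℕ.∸ 1 ≡ 3 ℕ.+ k′
      p∸1≡3+k′ = trans (cong (ℕ._∸ 1) p≡) (arith t)
        where
        arith : ∀ t → suc (suc t) ℕ.+ suc (suc t) ≡ 3 ℕ.+ (t ℕ.+ suc t)
        arith = ℕ.solve-∀

      p∸3≡k : p ℕ.∸ 3 ≡ k
      p∸3≡k = trans (cong (ℕ._∸ 3) p≡) (ℕ.+-suc t (suc t))

      1+k<p : suc k ℕ.< p
      1+k<p = subst (suc (suc k) ℕ.≤_) k+3≡p (ℕ.≤-trans (ℕ.n≤1+n (suc (suc k))) (ℕ.≤-reflexive (ℕ.+-comm 3 k)))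

      F F′ : ℕ → ℚ
      F  r = ℕ→ℚ r ^ k
      F′ r = ℕ→ℚ r ^ k′

      E G₃ G₄ : ℚ
      E  = powerSum p k
      G₃ = ∑< h F
      G₄ = ∑< h F′

      F-reflect : ∀ {r} → r ℕ.≤ p → F (p ℕ.∸ r) ≡ F r + 3 * ℕ→ℚ p * F′ r [p^ 2 ]
      F-reflect {r} r≤p = begin
        ℕ→ℚ (p ℕ.∸ r) ^ k
          ≡⟨ cong (_^ k) (trans (ℕ→ℚ-∸ r≤p) (flip (ℕ→ℚ p) x)) ⟩
        (- (x + - ℕ→ℚ p)) ^ k
          ≡⟨ ^-even-neg (x + - ℕ→ℚ p) (suc t) ⟩
        (x + - ℕ→ℚ p) ^ k
          ≈⟨ binomial₁ (∣-ℕ r) (∣-neg ∣-p) k′ ⟩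
        x ^ k + ℕ→ℚ k * - ℕ→ℚ p * x ^ k′
          ≡⟨ cong (λ c → x ^ k + c * - ℕ→ℚ p * x ^ k′) k≡p-3 ⟩
        x ^ k + (ℕ→ℚ p - 3) * - ℕ→ℚ p * x ^ k′
          ≡⟨ regroup (x ^ k) (ℕ→ℚ p) (x ^ k′) ⟩
        x ^ k + 3 * ℕ→ℚ p * x ^ k′ + ℕ→ℚ p * ℕ→ℚ p * - x ^ k′
          ≈⟨ +-congˡₚ (x ^ k + 3 * ℕ→ℚ p * x ^ k′) (∣⇒≡0 (∣-*ʳ (∣-* ∣-p ∣-p) (∣-neg (∣-ℕ^ r k′)))) ⟩
        x ^ k + 3 * ℕ→ℚ p * x ^ k′ + 0ℚ
          ≡⟨ ℚ.+-identityʳ _ ⟩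
        x ^ k + 3 * ℕ→ℚ p * x ^ k′ ∎
        where
        open ≡ₚ-Reasoning 2
        x = ℕ→ℚ r
        flip : ∀ a b → a - b ≡ - (b + - a)
        flip = solve-∀ ℚ-ring
        k≡p-3 : ℕ→ℚ k ≡ ℕ→ℚ p - 3
        k≡p-3 = trans (cong ℕ→ℚ (sym p∸3≡k)) (ℕ→ℚ-∸ (ℕ.<⇒≤ 3<p))
        regroup : ∀ a P b → a + (P - 3) * - P * b ≡ a + 3 * P * b + P * P * - b
        regroup = solve-∀ ℚ-ring

      ∑F≡E : ∑< (suc p) F ≡ E [p^ 2 ]
      ∑F≡E = begin
        E + F p
          ≈⟨ +-congˡₚ E (∣⇒≡0 (∣-p^≤ k (s≤s (ℕ.≤-trans (s≤s z≤n) (ℕ.m≤n+m (suc t) t))))) ⟩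
        E + 0ℚ
          ≡⟨ ℚ.+-identityʳ E ⟩
        E ∎
        where open ≡ₚ-Reasoning 2

      E≡2G₃+3pG₄ : E ≡ 2 * G₃ + 3 * ℕ→ℚ p * G₄ [p^ 2 ]
      E≡2G₃+3pG₄ = begin
        E                                          ≈⟨ ≡ₚ-sym ∑F≡E ⟩
        ∑< (suc p) F                               ≈⟨ fold-relation h F (λ r → 3 * ℕ→ℚ p * F′ r) h+h≡1+p F-reflect ⟩
        2 * G₃ + ∑[ r < h ] (3 * ℕ→ℚ p * F′ r)     ≡⟨ cong (2 * G₃ +_) (*-distribˡ-∑ h (3 * ℕ→ℚ p) F′) ⟨
        2 * G₃ + 3 * ℕ→ℚ p * G₄                    ∎
        where open ≡ₚ-Reasoning 2

      E≡4uG₃+3puG₄ : E ≡ 2 * (2 * 2 ^ k′) * G₃ + 3 * ℕ→ℚ p * 2 ^ k′ * G₄ [p^ 2 ]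
      E≡4uG₃+3puG₄ = begin
        E
          ≈⟨ ≡ₚ-sym ∑F≡E ⟩
        ∑< (suc p) F
          ≈⟨ fold-evens-relation h F (λ r → 3 * ℕ→ℚ p * F′ r) h+h≡1+p F-reflect ⟩
        ∑[ r < h ] (2 * F (r ℕ.+ r) + 3 * ℕ→ℚ p * F′ (r ℕ.+ r))
          ≡⟨ ∑-cong h (λ r _ → cong₂ (λ a b → 2 * a + 3 * ℕ→ℚ p * b) (ℕ→ℚ-double-^ r k) (ℕ→ℚ-double-^ r k′)) ⟩
        ∑[ r < h ] (2 * (2 ^ k * F r) + 3 * ℕ→ℚ p * (u * F′ r))
          ≡⟨ ∑-cong h (λ r _ → regroup (2 ^ k) u (ℕ→ℚ p) (F r) (F′ r)) ⟩
        ∑[ r < h ] (2 * 2 ^ k * F r + 3 * ℕ→ℚ p * u * F′ r)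
          ≡⟨ ∑-distrib-+ h _ _ ⟩
        ∑[ r < h ] (2 * 2 ^ k * F r) + ∑[ r < h ] (3 * ℕ→ℚ p * u * F′ r)
          ≡⟨ cong₂ _+_ (*-distribˡ-∑ h (2 * 2 ^ k) F) (*-distribˡ-∑ h (3 * ℕ→ℚ p * u) F′) ⟨
        2 * 2 ^ k * G₃ + 3 * ℕ→ℚ p * u * G₄
          ≡⟨ cong (λ v → 2 * v * G₃ + 3 * ℕ→ℚ p * u * G₄) (^-homo-* 2 1 k′) ⟩
        2 * (2 * u) * G₃ + 3 * ℕ→ℚ p * u * G₄ ∎
        where
        open ≡ₚ-Reasoning 2
        u = 2 ^ k′
        regroup : ∀ v u P f f′ → 2 * (v * f) + 3 * P * (u * f′) ≡ 2 * v * f + 3 * P * u * f′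
        regroup = solve-∀ ℚ-ring

      h≤p : h ℕ.≤ p
      h≤p = subst (h ℕ.≤_) (sym p≡) (s≤s (s≤s (s≤s (ℕ.m≤m+n t (suc (suc t))))))

      G₄∣ : p^[ 0 ]∣ G₄
      G₄∣ = ∣-∑ h (λ r _ → ∣-ℕ^ r k′)

      E≡pB : E ≡ ℕ→ℚ p * B k [p^ 2 ]
      E≡pB = powerSum≡pB k 1+k<p

      G₃≡0 : G₃ ≡ 0ℚ [p^ 1 ]
      G₃≡0 = cancelˡₚ 2 p∤2 (begin
        2 * G₃
          ≡⟨ add-sub (2 * G₃) (3 * ℕ→ℚ p * G₄) ⟩
        2 * G₃ + 3 * ℕ→ℚ p * G₄ - 3 * ℕ→ℚ p * G₄
          ≈⟨ +-congʳₚ (- (3 * ℕ→ℚ p * G₄)) (≡ₚ-sym (≡ₚ-weaken (ℕ.n≤1+n 1) E≡2G₃+3pG₄)) ⟩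
        E - 3 * ℕ→ℚ p * G₄
          ≈⟨ +-congₚ (powerSum≡0 k 1+k<p) (neg-congₚ (∣⇒≡0 (∣-*ʳ (∣-* (∣-ℕ 3) ∣-p) G₄∣))) ⟩
        0ℚ - 0ℚ
          ≡⟨⟩
        2 * 0ℚ ∎)
        where
        open ≡ₚ-Reasoning 1
        add-sub : ∀ x y → x ≡ x + y - y
        add-sub = solve-∀ ℚ-ring

      2E+pG₄≡0 : 2 * E + ℕ→ℚ p * G₄ ≡ 0ℚ [p^ 2 ]
      2E+pG₄≡0 = cancelˡₚ 3 p∤3 (begin
        3 * (2 * E + ℕ→ℚ p * G₄)
          ≡⟨ spread E (ℕ→ℚ p) G₄ ⟩
        8 * E - 2 * E + 3 * ℕ→ℚ p * G₄
          ≈⟨ +-congʳₚ (3 * ℕ→ℚ p * G₄) (+-congₚ (*-congˡₚ (∣-ℕ 8) E≡4uG₃+3puG₄) (neg-congₚ (*-congˡₚ (∣-ℕ 2) E≡2G₃+3pG₄))) ⟩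
        8 * (2 * (2 * u) * G₃ + 3 * ℕ→ℚ p * u * G₄) - 2 * (2 * G₃ + 3 * ℕ→ℚ p * G₄) + 3 * ℕ→ℚ p * G₄
          ≡⟨ collect u (ℕ→ℚ p) G₃ G₄ ⟩
        4 * ((8 * u - 1ℚ) * G₃) + 3 * ((8 * u - 1ℚ) * (ℕ→ℚ p * G₄))
          ≈⟨ +-congₚ (*-congˡₚ (∣-ℕ 4) (∣⇒≡0 (∣-* 8u-1∣ (≡0⇒∣ G₃≡0)))) (*-congˡₚ (∣-ℕ 3) (∣⇒≡0 (∣-* 8u-1∣ (∣-*ʳ ∣-p G₄∣)))) ⟩
        4 * 0ℚ + 3 * 0ℚ
          ≡⟨⟩
        3 * 0ℚ ∎)
        where
        open ≡ₚ-Reasoning 2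
        u = 2 ^ k′
        spread : ∀ e P g → 3 * (2 * e + P * g) ≡ 8 * e - 2 * e + 3 * P * g
        spread = solve-∀ ℚ-ring
        collect : ∀ u P g₃ g₄ → 8 * (2 * (2 * u) * g₃ + 3 * P * u * g₄) - 2 * (2 * g₃ + 3 * P * g₄) + 3 * P * g₄
                               ≡ 4 * ((8 * u - 1ℚ) * g₃) + 3 * ((8 * u - 1ℚ) * (P * g₄))
        collect = solve-∀ ℚ-ring
        8u-1∣ : p^[ 1 ]∣ 8 * u - 1ℚ
        8u-1∣ = subst (p^[ 1 ]∣_) (cong (_- 1ℚ) (trans (cong (2 ^_) p∸1≡3+k′) (^-homo-* 2 3 k′)))
                      (difference-∣ (fermat-unit p∤2))

      H₃≡G₄ : ∑< h (inv^ 3) ≡ G₄ [p^ 1 ]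
      H₃≡G₄ = ∑-congₚ h (λ r r<h → inv³≡F′ r (ℕ.≤-trans r<h h≤p))
        where
        inv³≡F′ : ∀ r → r ℕ.< p → inv^ 3 r ≡ F′ r [p^ 1 ]
        inv³≡F′ zero    _   = ≡ₚ-reflexive (trans (inv^-∣ 3 (divides 0 refl)) (sym zero^k′))
          where
          zero^k′ : 0ℚ ^ k′ ≡ 0ℚ
          zero^k′ = trans (cong (0ℚ ^_) (ℕ.+-suc t t)) (trans (^-homo-* 0ℚ 1 (t ℕ.+ t)) (ℚ.*-zeroˡ (0ℚ ^ (t ℕ.+ t))))
        inv³≡F′ (suc r) r<p = begin
          inv^ 3 (suc r)                   ≡⟨ inv^-∤ 3 p∤r ⟩
          a ^ 3                            ≡⟨ ℚ.*-identityʳ (a ^ 3) ⟨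
          a ^ 3 * 1ℚ                       ≈⟨ *-congˡₚ (∣-^ (∣-inv p∤r) 3) (≡ₚ-sym (fermat-unit p∤r)) ⟩
          a ^ 3 * x ^ (p ℕ.∸ 1)            ≡⟨ cong (λ n → a ^ 3 * x ^ n) p∸1≡3+k′ ⟩
          a ^ 3 * x ^ (3 ℕ.+ k′)           ≡⟨ cong (a ^ 3 *_) (^-homo-* x 3 k′) ⟩
          a ^ 3 * (x ^ 3 * x ^ k′)         ≡⟨ regroup a x (x ^ k′) ⟩
          (a * x) ^ 3 * x ^ k′             ≡⟨ cong (λ y → y ^ 3 * x ^ k′) (inv-*-unit p∤r) ⟩
          1ℚ ^ 3 * x ^ k′                  ≡⟨ ℚ.*-identityˡ (x ^ k′) ⟩
          x ^ k′                           ∎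
          where
          open ≡ₚ-Reasoning 1
          p∤r = p∤-<p (s≤s z≤n) r<p
          a = inv (suc r)
          x = ℕ→ℚ (suc r)
          regroup : ∀ a x y → a ^ 3 * (x ^ 3 * y) ≡ (a * x) ^ 3 * y
          regroup = solve-∀ ℚ-ring

      3S₁≡2pB : 3 * ∑< p (inv^ 2) ≡ 2 * ℕ→ℚ p * B k [p^ 2 ]
      3S₁≡2pB = begin
        3 * ∑< p (inv^ 2)                   ≡⟨ cong (λ P → 3 * ∑< P (inv^ 2)) p¹≡p ⟨
        3 * S₁                              ≡⟨ double-neg (3 * S₁) ⟩
        - (- (3 * S₁))                      ≈⟨ neg-congₚ (≡ₚ-sym PH₃≡-3S) ⟩
        - (ℕ→ℚ (p ℕ.^ 1) * H₃)              ≡⟨ cong (λ P → - (ℕ→ℚ P * H₃)) p¹≡p ⟩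
        - (ℕ→ℚ p * H₃)                      ≈⟨ neg-congₚ (p*-congₚ H₃≡G₄) ⟩
        - (ℕ→ℚ p * G₄)                      ≡⟨ isolate (2 * E) (ℕ→ℚ p * G₄) ⟩
        2 * E - (2 * E + ℕ→ℚ p * G₄)        ≈⟨ +-congˡₚ (2 * E) (neg-congₚ 2E+pG₄≡0) ⟩
        2 * E - 0ℚ                          ≡⟨ ℚ.+-identityʳ (2 * E) ⟩
        2 * E                               ≈⟨ *-congˡₚ (∣-ℕ 2) E≡pB ⟩
        2 * (ℕ→ℚ p * B k)                   ≡⟨ ℚ.*-assoc 2 (ℕ→ℚ p) (B k) ⟨
        2 * ℕ→ℚ p * B k                     ∎
        where
        open ≡ₚ-Reasoning 2
        p¹≡p : p ℕ.^ 1 ≡ p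
        p¹≡p = ℕ.*-identityʳ p
        open InverseSums {1} (s≤s z≤n) h (trans h+h≡1+p (cong suc (sym p¹≡p)))
          using (S≡2H₂+2PH₃; 4S≡2H₂+PH₃; H₂; H₃) renaming (S to S₁)
        PH₃≡-3S : ℕ→ℚ (p ℕ.^ 1) * H₃ ≡ - (3 * S₁) [p^ 2 ]
        PH₃≡-3S = proj₁ (half-relations {H = H₂} {Q = ℕ→ℚ (p ℕ.^ 1) * H₃} S≡2H₂+2PH₃ (4S≡2H₂+PH₃ p∤2))
        double-neg : ∀ x → x ≡ - (- x)
        double-neg = solve-∀ ℚ-ring
        isolate : ∀ e q → - q ≡ e - (e + q)
        isolate = solve-∀ ℚ-ring

    p≡2t+5 : ∃[ t ] p ≡ suc (suc (suc t) ℕ.+ suc (suc t))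
    p≡2t+5 with p-odd
    ... | zero , p≡1 = contradiction 5≤p (subst (λ n → ¬ 5 ℕ.≤ n) (sym p≡1) λ { (s≤s ()) })
    ... | suc zero , p≡3 = contradiction 5≤p (subst (λ n → ¬ 5 ℕ.≤ n) (sym p≡3) λ { (s≤s (s≤s (s≤s ()))) })
    ... | suc (suc t) , p≡ = t , p≡

    3S≡2PB : ∀ m → 3 * S (suc m) ≡ 2 * ℕ→ℚ (p ℕ.^ suc m) * B (p ℕ.∸ 3) [p^ suc (suc m) ]
    3S≡2PB zero = subst₂ (λ P b → 3 * ∑< P (inv^ 2) ≡ 2 * ℕ→ℚ P * B b [p^ 2 ]) (sym (ℕ.*-identityʳ p)) (sym p∸3≡k) 3S₁≡2pB
      where open BaseCase (proj₁ p≡2t+5) (proj₂ p≡2t+5)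
    3S≡2PB (suc m) = begin
      3 * S (suc (suc m))                               ≈⟨ *-congˡₚ (∣-ℕ 3) (S-step (s≤s z≤n)) ⟩
      3 * (ℕ→ℚ p * S (suc m))                           ≡⟨ swap 3 (ℕ→ℚ p) (S (suc m)) ⟩
      ℕ→ℚ p * (3 * S (suc m))                           ≈⟨ p*-congₚ (3S≡2PB m) ⟩
      ℕ→ℚ p * (2 * ℕ→ℚ (p ℕ.^ suc m) * B (p ℕ.∸ 3))     ≡⟨ regroup (ℕ→ℚ p) (ℕ→ℚ (p ℕ.^ suc m)) (B (p ℕ.∸ 3)) ⟩
      2 * (ℕ→ℚ p * ℕ→ℚ (p ℕ.^ suc m)) * B (p ℕ.∸ 3)     ≡⟨ cong (λ x → 2 * x * B (p ℕ.∸ 3)) (ℕ→ℚ-* p (p ℕ.^ suc m)) ⟨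
      2 * ℕ→ℚ (p ℕ.^ suc (suc m)) * B (p ℕ.∸ 3)         ∎
      where
      open ≡ₚ-Reasoning (suc (suc (suc m)))
      swap : ∀ a b c → a * (b * c) ≡ b * (a * c)
      swap = solve-∀ ℚ-ring
      regroup : ∀ a b c → a * (2 * b * c) ≡ 2 * (a * b) * c
      regroup = solve-∀ ℚ-ring

    invSq≡inv² : ∀ k → invSq k ≡ inv k ^ 2
    invSq≡inv² zero    = refl
    invSq≡inv² (suc k) = refl

    masked-invSq : ∀ k {b} → b ≡ false → (if does (p ∣? k) ∨ b then 0ℚ else invSq k) ≡ inv^ 2 k
    masked-invSq k refl = cong₂ (λ c y → if c then 0ℚ else y) (∨-identityʳ (does (p ∣? k))) (invSq≡inv² k)

    masked-zero : ∀ k {b} y → b ≡ true → (if does (p ∣? k) ∨ b then 0ℚ else y) ≡ 0ℚ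
    masked-zero k y refl = cong (λ c → if c then 0ℚ else y) (∨-zeroʳ (does (p ∣? k)))

    2*≡+ : ∀ x → 2 ℕ.* x ≡ x ℕ.+ x
    2*≡+ x = cong (x ℕ.+_) (ℕ.+-identityʳ x)

    module HalfRanges {m} (n h : ℕ) (h+h≡1+P : h ℕ.+ h ≡ suc (p ℕ.^ m)) where

      P : ℕ
      P = p ℕ.^ m

      h≤r⇒P<r+r : ∀ {r} → h ℕ.≤ r → P ℕ.< r ℕ.+ r
      h≤r⇒P<r+r {r} h≤r = subst (ℕ._≤ r ℕ.+ r) h+h≡1+P (ℕ.+-mono-≤ h≤r h≤r)

      h≤P : h ℕ.≤ P
      h≤P = ℕ.≤-pred (subst (suc h ℕ.≤_) h+h≡1+P (subst (ℕ._≤ h ℕ.+ h) (ℕ.+-comm h 1) (ℕ.+-monoʳ-≤ h 1≤h)))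
        where
        1≤h : 1 ℕ.≤ h
        1≤h = ℕ.n≢0⇒n>0 (λ h≡0 → ℕ.0≢1+n (trans (cong (λ x → x ℕ.+ x) (sym h≡0)) h+h≡1+P))

      sumLower≡ : sumLower p n m ≡ ∑[ r < h ] inv^ 2 (n ℕ.* P ℕ.+ r)
      sumLower≡ = begin
        sumLower p n m                         ≡⟨ sumℚ-upTo P term ⟩
        ∑< P term                              ≡⟨ ∑-vanishing-tail term h≤P (λ r h≤r _ → outside h≤r) ⟩
        ∑< h term                              ≡⟨ ∑-cong h (λ r r<h → inside r<h) ⟩
        ∑[ r < h ] inv^ 2 (n ℕ.* P ℕ.+ r)      ∎
        where
        open ≡-Reasoning
        term : ℕ → ℚ
        term r = if does (p ∣? (n ℕ.* P ℕ.+ r)) ∨ not (does (2 ℕ.* r ℕ.<? P)) then 0ℚ else invSq (n ℕ.* P ℕ.+ r)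
        inside : ∀ {r} → r ℕ.< h → term r ≡ inv^ 2 (n ℕ.* P ℕ.+ r)
        inside {r} r<h = masked-invSq (n ℕ.* P ℕ.+ r)
          (cong not (dec-true (2 ℕ.* r ℕ.<? P) (subst (ℕ._< P) (sym (2*≡+ r)) (r<h⇒r+r<P h+h≡1+P r<h))))
        outside : ∀ {r} → h ℕ.≤ r → term r ≡ 0ℚ
        outside {r} h≤r = masked-zero (n ℕ.* P ℕ.+ r) (invSq (n ℕ.* P ℕ.+ r))
          (cong not (dec-false (2 ℕ.* r ℕ.<? P) (λ 2r<P → ℕ.<-asym (subst (ℕ._< P) (2*≡+ r) 2r<P) (h≤r⇒P<r+r h≤r))))

      reflect-inside : ∀ {s} → s ℕ.+ s ℕ.< P → P ℕ.< P ℕ.∸ s ℕ.+ (P ℕ.∸ s)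
      reflect-inside {s} s+s<P =
        subst (ℕ._< d ℕ.+ d) (sym P≡d+s) (ℕ.+-monoʳ-< d (ℕ.+-cancelʳ-< s s d (subst (s ℕ.+ s ℕ.<_) P≡d+s s+s<P)))
        where
        d = P ℕ.∸ s
        P≡d+s : P ≡ d ℕ.+ s
        P≡d+s = sym (ℕ.m∸n+n≡m (ℕ.≤-trans (ℕ.m≤m+n s s) (ℕ.<⇒≤ s+s<P)))

      reflect-outside : ∀ {s} → P ℕ.≤ s ℕ.+ s → s ℕ.≤ P → P ℕ.∸ s ℕ.+ (P ℕ.∸ s) ℕ.≤ P
      reflect-outside {s} P≤s+s s≤P =
        subst (d ℕ.+ d ℕ.≤_) (sym P≡d+s) (ℕ.+-monoʳ-≤ d (ℕ.+-cancelʳ-≤ s d s (subst (ℕ._≤ s ℕ.+ s) P≡d+s P≤s+s)))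
        where
        d = P ℕ.∸ s
        P≡d+s : P ≡ d ℕ.+ s
        P≡d+s = sym (ℕ.m∸n+n≡m s≤P)

      sumUpper≡ : p ∣ P → sumUpper p n m ≡ ∑[ s < h ] inv^ 2 (P ℕ.+ n ℕ.* P ℕ.∸ s)
      sumUpper≡ p∣P = begin
        sumUpper p n m
          ≡⟨ sumℚ-upTo P term ⟩
        ∑< P term
          ≡⟨ ∑-reflect P term (trans term-0 (sym term-P)) ⟩
        ∑[ s < P ] term (P ℕ.∸ s)
          ≡⟨ ∑-vanishing-tail (λ s → term (P ℕ.∸ s)) h≤P (λ s h≤s s<P → outside h≤s (ℕ.<⇒≤ s<P)) ⟩
        ∑[ s < h ] term (P ℕ.∸ s)
          ≡⟨ ∑-cong h (λ s s<h → inside s<h) ⟩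
        ∑[ s < h ] inv^ 2 (P ℕ.+ n ℕ.* P ℕ.∸ s) ∎
        where
        open ≡-Reasoning
        term : ℕ → ℚ
        term r = if does (p ∣? (n ℕ.* P ℕ.+ r)) ∨ not (does (P ℕ.<? 2 ℕ.* r)) then 0ℚ else invSq (n ℕ.* P ℕ.+ r)

        term-0 : term 0 ≡ 0ℚ
        term-0 = masked-zero (n ℕ.* P ℕ.+ 0) (invSq (n ℕ.* P ℕ.+ 0)) (cong not (dec-false (P ℕ.<? 0) λ ()))

        term-P : term P ≡ 0ℚ
        term-P = cong (λ c → if c ∨ not (does (P ℕ.<? 2 ℕ.* P)) then 0ℚ else invSq (n ℕ.* P ℕ.+ P))
                      (dec-true (p ∣? (n ℕ.* P ℕ.+ P)) (∣m∣n⇒∣m+n (∣-trans p∣P (n∣m*n n)) p∣P))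

        inside : ∀ {s} → s ℕ.< h → term (P ℕ.∸ s) ≡ inv^ 2 (P ℕ.+ n ℕ.* P ℕ.∸ s)
        inside {s} s<h = trans
          (masked-invSq (n ℕ.* P ℕ.+ (P ℕ.∸ s))
            (cong not (dec-true (P ℕ.<? 2 ℕ.* (P ℕ.∸ s)) (subst (P ℕ.<_) (sym (2*≡+ (P ℕ.∸ s))) (reflect-inside {s} s+s<P)))))
          (cong (inv^ 2) (trans (ℕ.+-comm (n ℕ.* P) (P ℕ.∸ s))
                                (sym (ℕ.+-∸-comm (n ℕ.* P) (ℕ.≤-trans (ℕ.m≤m+n s s) (ℕ.<⇒≤ s+s<P))))))
          where
          s+s<P = r<h⇒r+r<P h+h≡1+P s<h

        outside : ∀ {s} → h ℕ.≤ s → s ℕ.≤ P → term (P ℕ.∸ s) ≡ 0ℚ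
        outside {s} h≤s s≤P = masked-zero (n ℕ.* P ℕ.+ (P ℕ.∸ s)) (invSq (n ℕ.* P ℕ.+ (P ℕ.∸ s)))
          (cong not (dec-false (P ℕ.<? 2 ℕ.* (P ℕ.∸ s))
            (λ P<2[P∸s] → ℕ.<⇒≱ (subst (P ℕ.<_) (2*≡+ (P ℕ.∸ s)) P<2[P∸s])
                                 (reflect-outside {s} (ℕ.<⇒≤ (h≤r⇒P<r+r h≤s)) s≤P))))


    module Congruences (n m : ℕ) where

      P : ℕ
      P = p ℕ.^ suc m

      h : ℕ
      h = proj₁ (half (suc m))

      h+h≡1+P : h ℕ.+ h ≡ suc P
      h+h≡1+P = proj₂ (half (suc m))

      open InverseSums {suc m} (s≤s z≤n) h h+h≡1+P using (p∣P; P∣; H₂; H₃; S≡2H₂+2PH₃; 4S≡2H₂+PH₃)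
      open HalfRanges {suc m} n h h+h≡1+P using (h≤P; sumLower≡; sumUpper≡)

      PH₃≡-3S : ℕ→ℚ P * H₃ ≡ - (3 * S (suc m)) [p^ suc (suc m) ]
      PH₃≡-3S = ≡ₚ-weaken (1+m≤m+m (s≤s z≤n)) (proj₁ (half-relations {H = H₂} {Q = ℕ→ℚ P * H₃} S≡2H₂+2PH₃ (4S≡2H₂+PH₃ p∤2)))

      2H₂≡7S : 2 * H₂ ≡ 7 * S (suc m) [p^ suc (suc m) ]
      2H₂≡7S = ≡ₚ-weaken (1+m≤m+m (s≤s z≤n)) (proj₂ (half-relations {H = H₂} {Q = ℕ→ℚ P * H₃} S≡2H₂+2PH₃ (4S≡2H₂+PH₃ p∤2)))

      third-of : ∀ c → (ℤ.+ c / 3) * 3 ≡ ℕ→ℚ c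
      third-of c = i/n*n≡i (ℤ.+ c) 2

      lower : sumLower p n (suc m) ≡ ((ℤ.+ (12 ℕ.* n ℕ.+ 7) / 3) * ℕ→ℚ P) * B (p ℕ.∸ 3) [p^ suc m ℕ.+ 1 ]
      lower = ≡ₚ-weaken (ℕ.≤-reflexive (ℕ.+-comm (suc m) 1)) (cancelˡₚ 6 p∤6 (begin
        6 * sumLower p n (suc m)
          ≡⟨ cong (6 *_) sumLower≡ ⟩
        6 * (∑[ r < h ] inv^ 2 (n ℕ.* P ℕ.+ r))
          ≈⟨ *-congˡₚ (∣-ℕ 6) (≡ₚ-weaken (1+m≤m+m (s≤s z≤n))
               (∑-inv²-shift₁ (∣-trans p∣P (n∣m*n n)) (∣-ℕ-multiple (n∣m*n n)) h)) ⟩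
        6 * (H₂ - 2 * ℕ→ℚ (n ℕ.* P) * H₃)
          ≡⟨ cong (λ x → 6 * (H₂ - 2 * x * H₃)) (ℕ→ℚ-* n P) ⟩
        6 * (H₂ - 2 * (ℕ→ℚ n * ℕ→ℚ P) * H₃)
          ≡⟨ split H₂ H₃ (ℕ→ℚ n) (ℕ→ℚ P) ⟩
        3 * (2 * H₂) - 12 * ℕ→ℚ n * (ℕ→ℚ P * H₃)
          ≈⟨ +-congₚ (*-congˡₚ (∣-ℕ 3) 2H₂≡7S) (neg-congₚ (*-congˡₚ (∣-* (∣-ℕ 12) (∣-ℕ n)) PH₃≡-3S)) ⟩
        3 * (7 * S′) - 12 * ℕ→ℚ n * - (3 * S′)
          ≡⟨ combine S′ (ℕ→ℚ n) ⟩
        (12 * ℕ→ℚ n + 7) * (3 * S′)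
          ≈⟨ *-congˡₚ (∣-+ (∣-* (∣-ℕ 12) (∣-ℕ n)) (∣-ℕ 7)) (3S≡2PB m) ⟩
        (12 * ℕ→ℚ n + 7) * (2 * ℕ→ℚ P * B (p ℕ.∸ 3))
          ≡⟨ cong (λ c → c * (2 * ℕ→ℚ P * B (p ℕ.∸ 3))) coefficient ⟨
        (q * 3) * (2 * ℕ→ℚ P * B (p ℕ.∸ 3))
          ≡⟨ regroup q (ℕ→ℚ P) (B (p ℕ.∸ 3)) ⟩
        6 * (q * ℕ→ℚ P * B (p ℕ.∸ 3)) ∎))
        where
        open ≡ₚ-Reasoning (suc (suc m))
        S′ = S (suc m)
        q = ℤ.+ (12 ℕ.* n ℕ.+ 7) / 3
        coefficient : q * 3 ≡ 12 * ℕ→ℚ n + 7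
        coefficient = trans (third-of (12 ℕ.* n ℕ.+ 7)) (trans (ℕ→ℚ-+ (12 ℕ.* n) 7) (cong (_+ 7) (ℕ→ℚ-* 12 n)))
        split : ∀ a b n P → 6 * (a - 2 * (n * P) * b) ≡ 3 * (2 * a) - 12 * n * (P * b)
        split = solve-∀ ℚ-ring
        combine : ∀ s n → 3 * (7 * s) - 12 * n * - (3 * s) ≡ (12 * n + 7) * (3 * s)
        combine = solve-∀ ℚ-ring
        regroup : ∀ q P b → q * 3 * (2 * P * b) ≡ 6 * (q * P * b)
        regroup = solve-∀ ℚ-ring

      upper : sumUpper p n (suc m) ≡ (- ((ℤ.+ (12 ℕ.* n ℕ.+ 5) / 3) * ℕ→ℚ P)) * B (p ℕ.∸ 3) [p^ suc m ℕ.+ 1 ]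
      upper = ≡ₚ-weaken (ℕ.≤-reflexive (ℕ.+-comm (suc m) 1)) (cancelˡₚ 6 p∤6 (begin
        6 * sumUpper p n (suc m)
          ≡⟨ cong (6 *_) (sumUpper≡ p∣P) ⟩
        6 * (∑[ s < h ] inv^ 2 (N ℕ.∸ s))
          ≈⟨ *-congˡₚ (∣-ℕ 6) (≡ₚ-weaken (1+m≤m+m (s≤s z≤n))
               (∑-inv²-reflect (∣-trans p∣P (n∣m*n (suc n))) (∣-ℕ-multiple {suc m} (n∣m*n (suc n))) h h≤N)) ⟩
        6 * (H₂ + 2 * ℕ→ℚ N * H₃)
          ≡⟨ cong (λ x → 6 * (H₂ + 2 * x * H₃)) (trans (ℕ→ℚ-* (suc n) P) (cong (_* ℕ→ℚ P) (ℕ→ℚ-suc n))) ⟩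
        6 * (H₂ + 2 * ((ℕ→ℚ n + 1ℚ) * ℕ→ℚ P) * H₃)
          ≡⟨ split H₂ H₃ (ℕ→ℚ n) (ℕ→ℚ P) ⟩
        3 * (2 * H₂) + 12 * (ℕ→ℚ n + 1ℚ) * (ℕ→ℚ P * H₃)
          ≈⟨ +-congₚ (*-congˡₚ (∣-ℕ 3) 2H₂≡7S) (*-congˡₚ (∣-* (∣-ℕ 12) (∣-+ (∣-ℕ n) (∣-ℕ 1))) PH₃≡-3S) ⟩
        3 * (7 * S′) + 12 * (ℕ→ℚ n + 1ℚ) * - (3 * S′)
          ≡⟨ combine S′ (ℕ→ℚ n) ⟩
        - ((12 * ℕ→ℚ n + 5) * (3 * S′))
          ≈⟨ neg-congₚ (*-congˡₚ (∣-+ (∣-* (∣-ℕ 12) (∣-ℕ n)) (∣-ℕ 5)) (3S≡2PB m)) ⟩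
        - ((12 * ℕ→ℚ n + 5) * (2 * ℕ→ℚ P * B (p ℕ.∸ 3)))
          ≡⟨ cong (λ c → - (c * (2 * ℕ→ℚ P * B (p ℕ.∸ 3)))) coefficient ⟨
        - ((q * 3) * (2 * ℕ→ℚ P * B (p ℕ.∸ 3)))
          ≡⟨ regroup q (ℕ→ℚ P) (B (p ℕ.∸ 3)) ⟩
        6 * (- (q * ℕ→ℚ P) * B (p ℕ.∸ 3)) ∎))
        where
        open ≡ₚ-Reasoning (suc (suc m))
        N = P ℕ.+ n ℕ.* P
        h≤N = ℕ.≤-trans h≤P (ℕ.m≤m+n P (n ℕ.* P))
        S′ = S (suc m)
        q = ℤ.+ (12 ℕ.* n ℕ.+ 5) / 3
        coefficient : q * 3 ≡ 12 * ℕ→ℚ n + 5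
        coefficient = trans (third-of (12 ℕ.* n ℕ.+ 5)) (trans (ℕ→ℚ-+ (12 ℕ.* n) 5) (cong (_+ 5) (ℕ→ℚ-* 12 n)))
        split : ∀ a b n P → 6 * (a + 2 * ((n + 1ℚ) * P) * b) ≡ 3 * (2 * a) + 12 * (n + 1ℚ) * (P * b)
        split = solve-∀ ℚ-ring
        combine : ∀ s n → 3 * (7 * s) + 12 * (n + 1ℚ) * - (3 * s) ≡ - ((12 * n + 5) * (3 * s))
        combine = solve-∀ ℚ-ring
        regroup : ∀ q P b → - (q * 3 * (2 * P * b)) ≡ 6 * (- (q * P) * b)
        regroup = solve-∀ ℚ-ring

open import Defs
open import Data.Nat using (ℕ; suc; _≤_; _^_; _+_; _*_; _∸_)
open import Data.Nat.Primality using (Prime)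
open import Data.Integer using (+_)
open import Data.Rational using (ℚ; _/_; -_)
open import Data.Product using (_×_; _,_)

lemma2p3 : (p n m : ℕ) → Prime p → 5 ≤ p → 1 ≤ m →
    CongModPow p (m + 1) (sumLower p n m)
    (((+ (12 * n + 7) / 3) Data.Rational.* ℕ→ℚ (p ^ m)) Data.Rational.* B (p ∸ 3))
    × CongModPow p (m + 1) (sumUpper p n m)
    ((- ((+ (12 * n + 5) / 3) Data.Rational.* ℕ→ℚ (p ^ m))) Data.Rational.* B (p ∸ 3))
lemma2p3 p n (suc m) p-prime 5≤p _ = ≡ₚ⇒CongModPow lower , ≡ₚ⇒CongModPow upper
  where
  open PAdic p-prime using (≡ₚ⇒CongModPow)
  open Main.Congruences p-prime 5≤p n m using (lower; upper)
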